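{- A permutation $\pi\in\Sigma_n$ is braid-simple if and only if $\pi$ is connected and unimodal.
   Context: Permutations act on $[n]$; products composed right to left; $\tau_i=(i,i+1)$, $D(k,j)=\tau_k\tau_{k-1}\cdots\tau_j$ for $1\le j\le k\le n-1$. Every $\pi\ne\mathrm{Id}$ has a unique expression $\pi=D(k_1,j_1)\cdots D(k_s,j_s)$ with $1\le k_1<\dots<k_s\le n-1$, $j_a\le k_a$, whose number of letters equals the Coxeter length of $\pi$; $\pi$ is braid-simple if $\pi=\mathrm{Id}$ or each $\tau_i$ occurs at most once in this word. A subset of $[n]$ is connected (a segment) if it equals $\{i,i+1,\dots,j\}$. $\pi$ is connected if all its orbits are connected. A cycle, written $(k_1\,k_2\,\dots\,k_s)$ with $k_1$ its largest element, is unimodal if there is $1\le m\le s$ with $k_1>k_2>\dots>k_m<k_{m+1}<\dots<k_s$; $\pi$ is unimodal if all its cycles are unimodal. -}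

module Defs where

open import Data.Nat as ℕ using (ℕ; zero; suc; _∸_; _≤_; _<_)
open import Data.Fin as F using (Fin; toℕ)
open import Data.Fin.Properties using () renaming (_<?_ to _<F?_)
open import Data.Fin.Permutation using (Permutation′; _⟨$⟩ʳ_)
open import Data.List using (List; []; _∷_; map; concatMap; length; filter; cartesianProduct; allFin)
open import Data.List.Relation.Unary.All using (All)
open import Data.List.Relation.Unary.Linked using (Linked)
open import Data.List.Relation.Unary.Unique.Propositional using (Unique)
open import Data.Product using (Σ; ∃; ∃-syntax; _×_; _,_; proj₁; proj₂)
open import Data.Sum using (_⊎_)
open import Relation.Binary.PropositionalEquality using (_≡_; _≢_)
open import Relation.Nullary.Decidable using (_×-dec_)
open import Function.Bundles using (_⇔_)

-- Convention: [n] = {1,…,n} is represented by Fin n, element i ↦ Fin index i-1.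
-- The order on [n] is the order on Fin n (F._<_, F._≤_).

-- sw i : the transposition of the (0-based) positions i and i+1 (identity if i+1 ≥ n).
sw : ∀ {n} → ℕ → Fin n → Fin n
sw {suc (suc m)} zero F.zero = F.suc F.zero
sw {suc (suc m)} zero (F.suc F.zero) = F.zero
sw {suc (suc m)} zero x = x
sw {suc zero} zero F.zero = F.zero
sw {suc m} (suc i) F.zero = F.zero
sw {suc m} (suc i) (F.suc x) = F.suc (sw i x)

-- τ_i (1-based, 1 ≤ i ≤ n-1) swaps elements i and i+1 of [n].
τ : ∀ {n} → ℕ → Fin n → Fin n
τ i = sw (i ∸ 1)

-- A word in the letters τ_i, as a list of indices i; product composed right to left:
-- evalWord (i₁ ∷ i₂ ∷ … ∷ iₘ) = τ_{i₁} ∘ τ_{i₂} ∘ … ∘ τ_{iₘ}.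
evalWord : ∀ {n} → List ℕ → Fin n → Fin n
evalWord [] x = x
evalWord (i ∷ w) x = τ i (evalWord w x)

-- Letters of D(k,j) = τ_k τ_{k-1} ⋯ τ_j  (as the list k, k-1, …, j; assumes j ≤ k).
downFrom : ℕ → ℕ → List ℕ
downFrom k j = go (suc (k ∸ j)) k
  where
  go : ℕ → ℕ → List ℕ
  go zero _ = []
  go (suc c) i = i ∷ go c (i ∸ 1)

-- A D-expression D(k₁,j₁)⋯D(k_s,j_s) is given by the list of pairs (k_a , j_a).
DExpr : Set
DExpr = List (ℕ × ℕ)

letters : DExpr → List ℕ
letters = concatMap (λ p → downFrom (proj₁ p) (proj₂ p))

WellFormed : ℕ → DExpr → Set
WellFormed n e = All (λ p → (1 ≤ proj₂ p) × (proj₂ p ≤ proj₁ p) × (proj₁ p ≤ n ∸ 1)) e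
               × Linked _<_ (map proj₁ e)

-- Coxeter length of π = number of inversions.
inversions : ∀ {n} → Permutation′ n → ℕ
inversions {n} π = length (filter (λ p → (proj₁ p <F? proj₂ p) ×-dec ((π ⟨$⟩ʳ proj₂ p) <F? (π ⟨$⟩ʳ proj₁ p)))
                                  (cartesianProduct (allFin n) (allFin n)))

IsDExpressionOf : ∀ {n} → Permutation′ n → DExpr → Set
IsDExpressionOf {n} π e = WellFormed n e
                        × (∀ x → evalWord (letters e) x ≡ π ⟨$⟩ʳ x)
                        × length (letters e) ≡ inversions π

IsId : ∀ {n} → Permutation′ n → Set
IsId {n} π = ∀ (x : Fin n) → π ⟨$⟩ʳ x ≡ x

BraidSimple : ∀ {n} → Permutation′ n → Set
BraidSimple π = IsId π ⊎ (∃[ e ] (IsDExpressionOf π e × Unique (letters e)))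

iter : ∀ {n} → Permutation′ n → ℕ → Fin n → Fin n
iter π zero x = x
iter π (suc t) x = π ⟨$⟩ʳ (iter π t x)

InOrbit : ∀ {n} → Permutation′ n → Fin n → Fin n → Set
InOrbit π x y = ∃[ t ] (iter π t x ≡ y)

Connected : ∀ {n} → Permutation′ n → Set
Connected {n} π = ∀ (x : Fin n) → Σ (Fin n) λ i → Σ (Fin n) λ j → (∀ (y : Fin n) → (InOrbit π x y ⇔ (i F.≤ y × y F.≤ j)))

-- Unimodal: for each cycle (k₁ k₂ … k_s) with k₁ the largest element of the cycle
-- (so k_{t+1} = π^t(k₁), s the cycle length) there is 1 ≤ m ≤ s with
-- k₁ > ⋯ > k_m < k_{m+1} < ⋯ < k_s.
Unimodal : ∀ {n} → Permutation′ n → Set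
Unimodal {n} π =
  ∀ (k₁ : Fin n) (s : ℕ) →
    (∀ t → iter π t k₁ F.≤ k₁) →
    1 ≤ s → iter π s k₁ ≡ k₁ → (∀ r → 1 ≤ r → r < s → iter π r k₁ ≢ k₁) →
    ∃[ m ] (1 ≤ m × m ≤ s
           × (∀ t → 1 ≤ t → t < m → iter π t k₁ F.< iter π (t ∸ 1) k₁)
           × (∀ t → m ≤ t → t < s → iter π (t ∸ 1) k₁ F.< iter π t k₁))

module Submission where

-- Both conditions are equivalent to an arc condition on f = π ⟨$⟩ʳ_: every point strictly
-- inside a descent arc f x < y < x ascends, and every point strictly inside an ascent arc
-- x < y < f x descends.
--
-- In a D-expression with distinct letters, each block D(k, j)
-- acts after a permutation fixing every point below k, and composing such a permutation with
-- a rotation of a segment ending at k preserves and reflects the arc condition. Conversely,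
-- if x₀ is the first point moved by f, the arc condition forces f to shift every point
-- strictly between x₀ and f x₀ down by one, so f is the rotation of [x₀, f x₀] after a
-- permutation fixing every point below f x₀, and we recurse. Counting inversions row by row,
-- each such rotation adds exactly as many inversions as it has letters, so the expression is
-- reduced.
--
-- A point between the minimum and the maximum of an
-- orbit but outside it lies inside both an ascent arc and a descent arc of that orbit, so it
-- would have to both descend and ascend. Reading a cycle from its maximum, a point visited
-- after the first ascent and above the bottom of the initial decreasing run lies inside a
-- descent arc of that run, so it ascends. Conversely, on a unimodal cycle the descents are
-- the steps of the initial decreasing run and the ascents those of the final increasing run,
-- and the arc condition follows by comparing positions along these runs.

open import Defs
open import Data.Nat as ℕ using (ℕ; zero; suc; _+_; _*_; _∸_; z≤n; s≤s; _≤′_; ≤′-refl; ≤′-step)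
open import Data.Nat.Properties
open import Data.Nat.Solver using (module +-*-Solver)
open import Data.Fin as F using (Fin; toℕ)
import Data.Fin.Properties as FP
open import Data.Fin.Permutation using (Permutation′; _⟨$⟩ʳ_; _⟨$⟩ˡ_; inverseˡ; inverseʳ)
open import Data.List using (List; []; _∷_; _++_; map; length; filter; cartesianProduct; allFin; reverse)
import Data.List.Properties as LP
open import Data.List.Relation.Unary.All as All using (All; []; _∷_)
import Data.List.Relation.Unary.All.Properties as AllP
open import Data.List.Relation.Unary.AllPairs using ([]; _∷_)
open import Data.List.Relation.Unary.Any using (here; there)
import Data.List.Relation.Unary.Linked as Linked
open import Data.List.Relation.Unary.Linked.Properties using (Linked⇒AllPairs; AllPairs⇒Linked)
open import Data.List.Relation.Unary.Unique.Propositional using (Unique)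
import Data.List.Relation.Unary.Unique.Propositional.Properties as UniqueP
open import Data.List.Membership.Propositional using (_∈_)
open import Data.List.Membership.Propositional.Properties using (∈-++⁺ˡ; ∈-++⁺ʳ)
open import Data.Product using (_×_; ∃; _,_; proj₁; proj₂; map₁; map₂)
open import Data.Sum using (_⊎_; inj₁; inj₂; [_,_]′)
open import Data.Empty using (⊥; ⊥-elim)
open import Function using (_∘_; id)
open import Function.Bundles using (_⇔_; mk⇔; Equivalence)
open import Function.Properties.Equivalence using () renaming (trans to ⇔-trans)
open import Relation.Nullary using (¬_; Dec; yes; no)
open import Relation.Nullary.Decidable using (_×-dec_; _⊎-dec_)
open import Relation.Binary using (tri<; tri≈; tri>)
open import Relation.Binary.PropositionalEquality

open +-*-Solver using (solve; _:+_; _:*_; _:=_)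

≤∸1⇒< : ∀ {m n} → 1 ℕ.≤ m → m ℕ.≤ n ∸ 1 → m ℕ.< n
≤∸1⇒< {n = zero} 1≤m m≤0 = ⊥-elim (<⇒≱ 1≤m m≤0)
≤∸1⇒< {n = suc n} _ m≤n = s≤s m≤n

<⇒≤∸1 : ∀ {m n} → m ℕ.< n → m ℕ.≤ n ∸ 1
<⇒≤∸1 {n = suc n} (s≤s m≤n) = m≤n

minimal-witness : ∀ {P : ℕ → Set} → (∀ m → Dec (P m)) → ∀ p → P p
                → ∃ λ m → P m × m ℕ.≤ p × (∀ r → r ℕ.< m → ¬ P r)
minimal-witness P? p Pp with P? 0
... | yes P0 = 0 , P0 , z≤n , λ _ ()
minimal-witness P? zero P0 | no ¬P0 = ⊥-elim (¬P0 P0)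
minimal-witness P? (suc p) Pp | no ¬P0 with minimal-witness (P? ∘ suc) p Pp
... | m , Pm , m≤p , none-below = suc m , Pm , s≤s m≤p , λ { zero _ → ¬P0 ; (suc r) (s≤s r<m) → none-below r r<m }

module _ {A : Set} where

  unique-++⁻ʳ : ∀ (xs : List A) {ys} → Unique (xs ++ ys) → Unique ys
  unique-++⁻ʳ [] u = u
  unique-++⁻ʳ (x ∷ xs) (_ ∷ u) = unique-++⁻ʳ xs u

  unique-++⇒disjoint : ∀ (xs : List A) {ys v} → Unique (xs ++ ys) → v ∈ xs → v ∈ ys → ⊥
  unique-++⇒disjoint (x ∷ xs) (x∉ ∷ _) (here refl) v∈ys = All.lookup x∉ (∈-++⁺ʳ xs v∈ys) refl
  unique-++⇒disjoint (x ∷ xs) (_ ∷ u) (there v∈xs) v∈ys = unique-++⇒disjoint xs u v∈xs v∈ys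

  count : {P : A → Set} → (∀ x → Dec (P x)) → List A → ℕ
  count P? xs = length (filter P? xs)

  count-++ : ∀ {P : A → Set} (P? : ∀ x → Dec (P x)) xs ys → count P? (xs ++ ys) ≡ count P? xs + count P? ys
  count-++ P? xs ys = trans (cong length (LP.filter-++ P? xs ys)) (LP.length-++ (filter P? xs))

  count-cong : ∀ {P Q : A → Set} (P? : ∀ x → Dec (P x)) (Q? : ∀ x → Dec (Q x))
             → (∀ x → P x → Q x) → (∀ x → Q x → P x) → ∀ xs → count P? xs ≡ count Q? xs
  count-cong P? Q? P⇒Q Q⇒P xs = cong length (LP.filter-≐ P? Q? ((λ {x} → P⇒Q x) , (λ {x} → Q⇒P x)) xs)

  count-none : ∀ {P : A → Set} (P? : ∀ x → Dec (P x)) → (∀ x → ¬ P x) → ∀ xs → count P? xs ≡ 0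
  count-none P? ¬P xs = cong length (LP.filter-none P? {xs} (All.tabulate λ {x} _ → ¬P x))

  count-⊎ : ∀ {P Q : A → Set} (P? : ∀ x → Dec (P x)) (Q? : ∀ x → Dec (Q x)) → (∀ x → P x → Q x → ⊥)
          → ∀ xs → count (λ x → P? x ⊎-dec Q? x) xs ≡ count P? xs + count Q? xs
  count-⊎ P? Q? disjoint [] = refl
  count-⊎ P? Q? disjoint (x ∷ xs) with P? x | Q? x
  ... | yes Px | yes Qx = ⊥-elim (disjoint x Px Qx)
  ... | yes _  | no _   = cong suc (count-⊎ P? Q? disjoint xs)
  ... | no _   | yes _  = trans (cong suc (count-⊎ P? Q? disjoint xs)) (sym (+-suc _ _))
  ... | no _   | no _   = count-⊎ P? Q? disjoint xs

module _ {A B : Set} where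

  count-map : ∀ {P : B → Set} (P? : ∀ x → Dec (P x)) (g : A → B) xs → count P? (map g xs) ≡ count (P? ∘ g) xs
  count-map P? g [] = refl
  count-map P? g (x ∷ xs) with P? (g x)
  ... | yes _ = cong suc (count-map P? g xs)
  ... | no _  = count-map P? g xs

  count-rows : ∀ {P Q : A × B → Set} (P? : ∀ p → Dec (P p)) (Q? : ∀ p → Dec (Q p))
               (_≟_ : ∀ (x y : A) → Dec (x ≡ y)) (ys : List B) (x₀ : A) (k : ℕ)
             → (∀ x → x ≢ x₀ → count P? (map (x ,_) ys) ≡ count Q? (map (x ,_) ys))
             → count P? (map (x₀ ,_) ys) ≡ k + count Q? (map (x₀ ,_) ys)
             → ∀ xs → count P? (cartesianProduct xs ys) ≡ count (_≟ x₀) xs * k + count Q? (cartesianProduct xs ys)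
  count-rows P? Q? _≟_ ys x₀ k other-rows row-x₀ [] = refl
  count-rows P? Q? _≟_ ys x₀ k other-rows row-x₀ (x ∷ xs) with x ≟ x₀
  ... | yes refl = begin
    count P? (row ++ rest)                   ≡⟨ count-++ P? row rest ⟩
    count P? row + count P? rest             ≡⟨ cong₂ _+_ row-x₀ (count-rows P? Q? _≟_ ys x₀ k other-rows row-x₀ xs) ⟩
    (k + count Q? row) + (c * k + count Q? rest)
      ≡⟨ solve 4 (λ k r c r′ → (k :+ r) :+ (c :* k :+ r′) := (k :+ c :* k) :+ (r :+ r′)) refl
               k (count Q? row) c (count Q? rest) ⟩
    (k + c * k) + (count Q? row + count Q? rest) ≡⟨ cong ((k + c * k) +_) (sym (count-++ Q? row rest)) ⟩
    (k + c * k) + count Q? (row ++ rest)     ∎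
    where
    open ≡-Reasoning
    row rest : List (A × B)
    row = map (x₀ ,_) ys
    rest = cartesianProduct xs ys
    c : ℕ
    c = count (_≟ x₀) xs
  ... | no x≢x₀ = begin
    count P? (row ++ rest)                   ≡⟨ count-++ P? row rest ⟩
    count P? row + count P? rest             ≡⟨ cong₂ _+_ (other-rows x x≢x₀) (count-rows P? Q? _≟_ ys x₀ k other-rows row-x₀ xs) ⟩
    count Q? row + (c * k + count Q? rest)
      ≡⟨ solve 3 (λ r ck r′ → r :+ (ck :+ r′) := ck :+ (r :+ r′)) refl (count Q? row) (c * k) (count Q? rest) ⟩
    c * k + (count Q? row + count Q? rest)   ≡⟨ cong (c * k +_) (sym (count-++ Q? row rest)) ⟩
    c * k + count Q? (row ++ rest)           ∎
    where
    open ≡-Reasoning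
    row rest : List (A × B)
    row = map (x ,_) ys
    rest = cartesianProduct xs ys
    c : ℕ
    c = count (_≟ x₀) xs

allFin-suc : ∀ n → allFin (suc n) ≡ F.zero ∷ map F.suc (allFin n)
allFin-suc n = cong (F.zero ∷_) (sym (LP.map-tabulate id F.suc))

count-allFin-range : ∀ n a b → b ℕ.≤ n → count (λ (q : Fin n) → (a ℕ.≤? toℕ q) ×-dec (toℕ q ℕ.<? b)) (allFin n) ≡ b ∸ a
count-allFin-range n a zero _ = trans (count-none _ (λ { _ (_ , ()) }) (allFin n)) (sym (0∸n≡0 a))
count-allFin-range (suc n) zero (suc b) (s≤s b≤n) = begin
  count R (allFin (suc n))             ≡⟨ cong (count R) (allFin-suc n) ⟩
  suc (count R (map F.suc (allFin n))) ≡⟨ cong suc (count-map R F.suc (allFin n)) ⟩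
  suc (count (R ∘ F.suc) (allFin n))
    ≡⟨ cong suc (count-cong _ _ (λ _ (_ , q<b) → z≤n , ℕ.≤-pred q<b) (λ _ (_ , q<b) → z≤n , s≤s q<b) (allFin n)) ⟩
  suc (count (λ q → (0 ℕ.≤? toℕ q) ×-dec (toℕ q ℕ.<? b)) (allFin n)) ≡⟨ cong suc (count-allFin-range n 0 b b≤n) ⟩
  suc b                                ∎
  where
  open ≡-Reasoning
  R : ∀ q → Dec (0 ℕ.≤ toℕ q × toℕ q ℕ.< suc b)
  R q = (0 ℕ.≤? toℕ q) ×-dec (toℕ q ℕ.<? suc b)
count-allFin-range (suc n) (suc a) (suc b) (s≤s b≤n) = begin
  count R (allFin (suc n))             ≡⟨ cong (count R) (allFin-suc n) ⟩
  count R (map F.suc (allFin n))       ≡⟨ count-map R F.suc (allFin n) ⟩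
  count (R ∘ F.suc) (allFin n)
    ≡⟨ count-cong _ _ (λ _ (a≤q , q<b) → ℕ.≤-pred a≤q , ℕ.≤-pred q<b) (λ _ (a≤q , q<b) → s≤s a≤q , s≤s q<b) (allFin n) ⟩
  count (λ q → (a ℕ.≤? toℕ q) ×-dec (toℕ q ℕ.<? b)) (allFin n) ≡⟨ count-allFin-range n a b b≤n ⟩
  b ∸ a                                ∎
  where
  open ≡-Reasoning
  R : ∀ q → Dec (suc a ℕ.≤ toℕ q × toℕ q ℕ.< suc b)
  R q = (suc a ℕ.≤? toℕ q) ×-dec (toℕ q ℕ.<? suc b)

count-allFin-≡ : ∀ {n} (x₀ : Fin n) → count (λ q → q FP.≟ x₀) (allFin n) ≡ 1
count-allFin-≡ {n} x₀ = begin
  count (λ q → q FP.≟ x₀) (allFin n)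
    ≡⟨ count-cong _ _ (λ { _ refl → ≤-refl , ≤-refl })
                      (λ q (x₀≤q , q<1+x₀) → FP.toℕ-injective (≤-antisym (ℕ.≤-pred q<1+x₀) x₀≤q)) (allFin n) ⟩
  count (λ q → (toℕ x₀ ℕ.≤? toℕ q) ×-dec (toℕ q ℕ.<? suc (toℕ x₀))) (allFin n)
    ≡⟨ count-allFin-range n (toℕ x₀) (suc (toℕ x₀)) (FP.toℕ<n x₀) ⟩
  suc (toℕ x₀) ∸ toℕ x₀
    ≡⟨ m+n∸n≡m 1 (toℕ x₀) ⟩
  1 ∎
  where open ≡-Reasoning

module _ {n} (a : ℕ → Fin n) where

  upward-crossing : ∀ {y} r → a 0 F.< y → y F.< a r → (∀ t → t ℕ.< r → a t ≢ y)
                  → ∃ λ t → t ℕ.< r × a t F.< y × y F.< a (suc t)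
  upward-crossing zero a₀<y y<a₀ _ = ⊥-elim (<-asym a₀<y y<a₀)
  upward-crossing {y} (suc r) a₀<y y<aᵣ₊₁ avoids with ℕ.<-cmp (toℕ (a r)) (toℕ y)
  ... | tri< aᵣ<y _ _ = r , ≤-refl , aᵣ<y , y<aᵣ₊₁
  ... | tri≈ _ aᵣ≡y _ = ⊥-elim (avoids r ≤-refl (FP.toℕ-injective aᵣ≡y))
  ... | tri> _ _ y<aᵣ = map₂ (map₁ m≤n⇒m≤1+n) (upward-crossing r a₀<y y<aᵣ (λ t t<r → avoids t (m≤n⇒m≤1+n t<r)))

  downward-crossing : ∀ {y} r → y F.< a 0 → a r F.< y → (∀ t → t ℕ.< r → a t ≢ y)
                    → ∃ λ t → t ℕ.< r × y F.< a t × a (suc t) F.< y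
  downward-crossing zero y<a₀ a₀<y _ = ⊥-elim (<-asym a₀<y y<a₀)
  downward-crossing {y} (suc r) y<a₀ aᵣ₊₁<y avoids with ℕ.<-cmp (toℕ (a r)) (toℕ y)
  ... | tri> _ _ y<aᵣ = r , ≤-refl , y<aᵣ , aᵣ₊₁<y
  ... | tri≈ _ aᵣ≡y _ = ⊥-elim (avoids r ≤-refl (FP.toℕ-injective aᵣ≡y))
  ... | tri< aᵣ<y _ _ = map₂ (map₁ m≤n⇒m≤1+n) (downward-crossing r y<a₀ aᵣ<y (λ t t<r → avoids t (m≤n⇒m≤1+n t<r)))

  prefix-extend : ∀ {P : Fin n → Set} {b} → (∀ v → v ℕ.≤ b → P (a v)) → P (a (suc b)) → ∀ v → v ℕ.≤ suc b → P (a v)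
  prefix-extend up-to-b at-1+b v v≤1+b with m≤n⇒m<n∨m≡n v≤1+b
  ... | inj₁ v<1+b = up-to-b v (ℕ.≤-pred v<1+b)
  ... | inj₂ refl = at-1+b

  argmax-prefix : ∀ b → ∃ λ u → u ℕ.≤ b × ∀ v → v ℕ.≤ b → a v F.≤ a u
  argmax-prefix zero = 0 , z≤n , λ { zero _ → ≤-refl }
  argmax-prefix (suc b) with argmax-prefix b
  ... | u , u≤b , max with toℕ (a (suc b)) ℕ.≤? toℕ (a u)
  ...   | yes aᵦ₊₁≤aᵤ = u , m≤n⇒m≤1+n u≤b , prefix-extend {P = F._≤ a u} max aᵦ₊₁≤aᵤ
  ...   | no aᵦ₊₁≰aᵤ = suc b , ≤-refl ,
    prefix-extend {P = F._≤ a (suc b)} (λ v v≤b → ≤-trans (max v v≤b) (<⇒≤ (≰⇒> aᵦ₊₁≰aᵤ))) ≤-refl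

  argmin-prefix : ∀ b → ∃ λ u → u ℕ.≤ b × ∀ v → v ℕ.≤ b → a u F.≤ a v
  argmin-prefix zero = 0 , z≤n , λ { zero _ → ≤-refl }
  argmin-prefix (suc b) with argmin-prefix b
  ... | u , u≤b , min with toℕ (a u) ℕ.≤? toℕ (a (suc b))
  ...   | yes aᵤ≤aᵦ₊₁ = u , m≤n⇒m≤1+n u≤b , prefix-extend {P = a u F.≤_} min aᵤ≤aᵦ₊₁
  ...   | no aᵤ≰aᵦ₊₁ = suc b , ≤-refl ,
    prefix-extend {P = a (suc b) F.≤_} (λ v v≤b → ≤-trans (<⇒≤ (≰⇒> aᵤ≰aᵦ₊₁)) (min v v≤b)) ≤-refl

sw-fixes : ∀ {n} i (x : Fin n) → toℕ x ≢ i → toℕ x ≢ suc i → sw i x ≡ x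
sw-fixes {suc (suc m)} zero F.zero x≢i _ = ⊥-elim (x≢i refl)
sw-fixes {suc (suc m)} zero (F.suc F.zero) _ x≢1+i = ⊥-elim (x≢1+i refl)
sw-fixes {suc (suc m)} zero (F.suc (F.suc x)) _ _ = refl
sw-fixes {suc zero} zero F.zero _ _ = refl
sw-fixes {suc zero} (suc i) F.zero _ _ = refl
sw-fixes {suc (suc m)} (suc i) F.zero _ _ = refl
sw-fixes {suc (suc m)} (suc i) (F.suc x) x≢i x≢1+i =
  cong F.suc (sw-fixes i x (x≢i ∘ cong suc) (x≢1+i ∘ cong suc))

sw-lower : ∀ {n} i (x : Fin n) → suc i ℕ.< n → toℕ x ≡ i → toℕ (sw i x) ≡ suc i
sw-lower {suc (suc m)} zero F.zero _ _ = refl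
sw-lower {suc zero} zero F.zero (s≤s ()) _
sw-lower {suc (suc m)} (suc i) (F.suc x) (s≤s i<m) x≡i = cong suc (sw-lower i x i<m (suc-injective x≡i))

sw-upper : ∀ {n} i (x : Fin n) → toℕ x ≡ suc i → toℕ (sw i x) ≡ i
sw-upper {suc (suc m)} zero (F.suc F.zero) _ = refl
sw-upper {suc (suc m)} zero (F.suc (F.suc x)) ()
sw-upper {suc (suc m)} (suc i) (F.suc x) x≡1+i = cong suc (sw-upper i x (suc-injective x≡1+i))

sw-involutive : ∀ {n} i (x : Fin n) → sw i (sw i x) ≡ x
sw-involutive {suc (suc m)} zero F.zero = refl
sw-involutive {suc (suc m)} zero (F.suc F.zero) = refl
sw-involutive {suc (suc m)} zero (F.suc (F.suc x)) = refl
sw-involutive {suc zero} zero F.zero = refl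
sw-involutive {suc zero} (suc i) F.zero = refl
sw-involutive {suc (suc m)} (suc i) F.zero = refl
sw-involutive {suc (suc m)} (suc i) (F.suc x) = cong F.suc (sw-involutive i x)

evalWord-++ : ∀ {n} (w₁ w₂ : List ℕ) (x : Fin n) → evalWord (w₁ ++ w₂) x ≡ evalWord w₁ (evalWord w₂ x)
evalWord-++ [] w₂ x = refl
evalWord-++ (i ∷ w₁) w₂ x = cong (τ i) (evalWord-++ w₁ w₂ x)

evalWord-injective : ∀ {n} (w : List ℕ) {x y : Fin n} → evalWord w x ≡ evalWord w y → x ≡ y
evalWord-injective [] eq = eq
evalWord-injective (i ∷ w) {x} {y} eq = evalWord-injective w (begin
  evalWord w x                          ≡⟨ sym (sw-involutive (i ∸ 1) _) ⟩
  τ i (τ i (evalWord w x))              ≡⟨ cong (τ i) eq ⟩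
  τ i (τ i (evalWord w y))              ≡⟨ sw-involutive (i ∸ 1) _ ⟩
  evalWord w y                          ∎)
  where open ≡-Reasoning

evalWord-reverse-inverseʳ : ∀ {n} (w : List ℕ) (x : Fin n) → evalWord w (evalWord (reverse w) x) ≡ x
evalWord-reverse-inverseʳ [] x = refl
evalWord-reverse-inverseʳ (i ∷ w) x = begin
  τ i (evalWord w (evalWord (reverse (i ∷ w)) x))     ≡⟨ cong (λ v → τ i (evalWord w (evalWord v x))) (LP.unfold-reverse i w) ⟩
  τ i (evalWord w (evalWord (reverse w ++ i ∷ []) x)) ≡⟨ cong (τ i ∘ evalWord w) (evalWord-++ (reverse w) (i ∷ []) x) ⟩
  τ i (evalWord w (evalWord (reverse w) (τ i x)))     ≡⟨ cong (τ i) (evalWord-reverse-inverseʳ w (τ i x)) ⟩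
  τ i (τ i x)                                         ≡⟨ sw-involutive (i ∸ 1) x ⟩
  x                                                   ∎
  where open ≡-Reasoning

evalWord-reverse-inverseˡ : ∀ {n} (w : List ℕ) (x : Fin n) → evalWord (reverse w) (evalWord w x) ≡ x
evalWord-reverse-inverseˡ w x =
  subst (λ v → evalWord (reverse w) (evalWord v x) ≡ x) (LP.reverse-involutive w)
        (evalWord-reverse-inverseʳ (reverse w) x)

evalWord-fixes-below : ∀ {n} b (w : List ℕ) (x : Fin n) → All (b ℕ.<_) w → toℕ x ℕ.< b → evalWord w x ≡ x
evalWord-fixes-below b [] x _ _ = refl
evalWord-fixes-below b (suc ℓ ∷ w) x (s≤s b≤ℓ ∷ b<w) x<b
  rewrite evalWord-fixes-below b w x b<w x<b =
  sw-fixes ℓ x (λ x≡ℓ → <-irrefl x≡ℓ (<-≤-trans x<b b≤ℓ))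
               (λ x≡1+ℓ → <-irrefl x≡1+ℓ (<-≤-trans x<b (m≤n⇒m≤1+n b≤ℓ)))

downFrom-suc : ∀ {k j} → j ℕ.≤ k → downFrom (suc k) j ≡ suc k ∷ downFrom k j
downFrom-suc j≤k rewrite +-∸-assoc 1 j≤k = refl

downFrom-self : ∀ k → downFrom k k ≡ k ∷ []
downFrom-self k rewrite n∸n≡0 k = refl

∈-downFrom⁻ : ∀ {k j ℓ} → j ℕ.≤ k → ℓ ∈ downFrom k j → j ℕ.≤ ℓ × ℓ ℕ.≤ k
∈-downFrom⁻ {k} {j} {ℓ} j≤k = go (≤⇒≤′ j≤k)
  where
  go : ∀ {k} → j ≤′ k → ℓ ∈ downFrom k j → j ℕ.≤ ℓ × ℓ ℕ.≤ k
  go ≤′-refl ℓ∈ rewrite downFrom-self j with ℓ∈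
  ... | here refl = ≤-refl , ≤-refl
  go (≤′-step j≤′k) ℓ∈ rewrite downFrom-suc (≤′⇒≤ j≤′k) with ℓ∈
  ... | here refl = m≤n⇒m≤1+n (≤′⇒≤ j≤′k) , ≤-refl
  ... | there ℓ∈′ = map₂ m≤n⇒m≤1+n (go j≤′k ℓ∈′)

∈-downFrom⁺ : ∀ {k j ℓ} → j ℕ.≤ ℓ → ℓ ℕ.≤ k → ℓ ∈ downFrom k j
∈-downFrom⁺ {k} {j} {ℓ} j≤ℓ ℓ≤k = go (≤⇒≤′ (≤-trans j≤ℓ ℓ≤k)) ℓ≤k
  where
  go : ∀ {k} → j ≤′ k → ℓ ℕ.≤ k → ℓ ∈ downFrom k j
  go ≤′-refl ℓ≤j rewrite downFrom-self j = here (≤-antisym ℓ≤j j≤ℓ)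
  go (≤′-step j≤′k) ℓ≤1+k rewrite downFrom-suc (≤′⇒≤ j≤′k) with m≤n⇒m<n∨m≡n ℓ≤1+k
  ... | inj₁ (s≤s ℓ≤k) = there (go j≤′k ℓ≤k)
  ... | inj₂ refl = here refl

downFrom-unique : ∀ {k j} → j ℕ.≤ k → Unique (downFrom k j)
downFrom-unique {k} {j} j≤k = go (≤⇒≤′ j≤k)
  where
  go : ∀ {k} → j ≤′ k → Unique (downFrom k j)
  go ≤′-refl rewrite downFrom-self j = All.[] ∷ []
  go {suc k} (≤′-step j≤′k) rewrite downFrom-suc (≤′⇒≤ j≤′k) =
    All.tabulate (λ ℓ∈ 1+k≡ℓ → <-irrefl (sym 1+k≡ℓ) (s≤s (proj₂ (∈-downFrom⁻ (≤′⇒≤ j≤′k) ℓ∈)))) ∷ go j≤′k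

length-downFrom : ∀ {k j} → j ℕ.≤ k → length (downFrom k j) ≡ suc (k ∸ j)
length-downFrom {k} {j} j≤k = go (≤⇒≤′ j≤k)
  where
  go : ∀ {k} → j ≤′ k → length (downFrom k j) ≡ suc (k ∸ j)
  go ≤′-refl rewrite n∸n≡0 j = refl
  go (≤′-step j≤′k) rewrite +-∸-assoc 1 (≤′⇒≤ j≤′k) = cong suc (go j≤′k)

record Rotates {n} (lo hi : ℕ) (d : Fin n → Fin n) : Set where
  field
    lo↦hi       : ∀ x → toℕ x ≡ lo → toℕ (d x) ≡ hi
    shifts-down : ∀ x → lo ℕ.< toℕ x → toℕ x ℕ.≤ hi → suc (toℕ (d x)) ≡ toℕ x
    fixes-below : ∀ x → toℕ x ℕ.< lo → d x ≡ x
    fixes-above : ∀ x → hi ℕ.< toℕ x → d x ≡ x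
open Rotates

rotates-refl : ∀ {n} lo → Rotates {n} lo lo id
rotates-refl lo = record
  { lo↦hi       = λ _ x≡lo → x≡lo
  ; shifts-down = λ _ lo<x x≤lo → ⊥-elim (<⇒≱ lo<x x≤lo)
  ; fixes-below = λ _ _ → refl
  ; fixes-above = λ _ _ → refl
  }

rotates-step : ∀ {n lo hi d} → lo ℕ.≤ hi → suc hi ℕ.< n → Rotates {n} lo hi d → Rotates lo (suc hi) (sw hi ∘ d)
rotates-step {n} {lo} {hi} {d} lo≤hi 1+hi<n rot = record
  { lo↦hi       = λ x x≡lo → sw-lower hi (d x) 1+hi<n (lo↦hi rot x x≡lo)
  ; shifts-down = shifts
  ; fixes-below = λ x x<lo → trans (cong (sw hi) (fixes-below rot x x<lo))
                                   (sw-fixes hi x (<⇒≢ (<-≤-trans x<lo lo≤hi))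
                                                  (<⇒≢ (<-≤-trans x<lo (m≤n⇒m≤1+n lo≤hi))))
  ; fixes-above = λ x 1+hi<x → trans (cong (sw hi) (fixes-above rot x (<-trans (n<1+n hi) 1+hi<x)))
                                     (sw-fixes hi x (>⇒≢ (<-trans (n<1+n hi) 1+hi<x)) (>⇒≢ 1+hi<x))
  }
  where
  shifts : ∀ x → lo ℕ.< toℕ x → toℕ x ℕ.≤ suc hi → suc (toℕ (sw hi (d x))) ≡ toℕ x
  shifts x lo<x x≤1+hi with m≤n⇒m<n∨m≡n x≤1+hi
  ... | inj₁ (s≤s x≤hi) = trans (cong (suc ∘ toℕ) (sw-fixes hi (d x) (<⇒≢ dx<hi) (<⇒≢ (m<n⇒m<1+n dx<hi))))
                                (shifts-down rot x lo<x x≤hi)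
    where
    dx<hi : toℕ (d x) ℕ.< hi
    dx<hi = subst (ℕ._≤ hi) (sym (shifts-down rot x lo<x x≤hi)) x≤hi
  ... | inj₂ x≡1+hi = trans (cong suc (trans (cong (toℕ ∘ sw hi) (fixes-above rot x (≤-reflexive (sym x≡1+hi))))
                                             (sw-upper hi x x≡1+hi)))
                            (sym x≡1+hi)

downFrom-rotates : ∀ {n lo hi} → lo ℕ.< hi → hi ℕ.< n → Rotates {n} lo hi (evalWord (downFrom hi (suc lo)))
downFrom-rotates {n} {lo} lo<hi = go (≤⇒≤′ lo<hi)
  where
  go : ∀ {hi} → suc lo ≤′ hi → hi ℕ.< n → Rotates lo hi (evalWord (downFrom hi (suc lo)))
  go ≤′-refl 1+lo<n = subst (Rotates lo (suc lo) ∘ evalWord) (sym (downFrom-self (suc lo)))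
                             (rotates-step ≤-refl 1+lo<n (rotates-refl lo))
  go {suc hi} (≤′-step lo<′hi) 1+hi<n =
    subst (Rotates lo (suc hi) ∘ evalWord) (sym (downFrom-suc (≤′⇒≤ lo<′hi)))
          (rotates-step (<⇒≤ (≤′⇒≤ lo<′hi)) 1+hi<n (go lo<′hi (<-trans (n<1+n hi) 1+hi<n)))

module _ {n lo hi} {d : Fin n → Fin n} (d-rotates : Rotates lo hi d) (lo≤hi : lo ℕ.≤ hi) where

  rotates-lower-bound : ∀ {v} → lo ℕ.≤ toℕ v → lo ℕ.≤ toℕ (d v)
  rotates-lower-bound {v} lo≤v with m≤n⇒m<n∨m≡n lo≤v | toℕ v ℕ.≤? hi
  ... | inj₂ lo≡v | _ = subst (lo ℕ.≤_) (sym (lo↦hi d-rotates v (sym lo≡v))) lo≤hi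
  ... | inj₁ lo<v | yes v≤hi = ℕ.≤-pred (subst (lo ℕ.<_) (sym (shifts-down d-rotates v lo<v v≤hi)) lo<v)
  ... | inj₁ _    | no v≰hi = subst (λ z → lo ℕ.≤ toℕ z) (sym (fixes-above d-rotates v (≰⇒> v≰hi))) lo≤v

  rotates-non-increasing : ∀ {u} → toℕ u ≢ lo → d u F.≤ u
  rotates-non-increasing {u} u≢lo with ℕ.<-cmp (toℕ u) lo | toℕ u ℕ.≤? hi
  ... | tri< u<lo _ _ | _ = ≤-reflexive (cong toℕ (fixes-below d-rotates u u<lo))
  ... | tri≈ _ u≡lo _ | _ = ⊥-elim (u≢lo u≡lo)
  ... | tri> _ _ lo<u | yes u≤hi = <⇒≤ (≤-reflexive (shifts-down d-rotates u lo<u u≤hi))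
  ... | tri> _ _ _    | no u≰hi = ≤-reflexive (cong toℕ (fixes-above d-rotates u (≰⇒> u≰hi)))

  rotates-monotone : ∀ {u v} → toℕ u ≢ lo → u F.< v → d u F.< d v
  rotates-monotone {u} {v} u≢lo u<v with ℕ.<-cmp (toℕ u) lo
  ... | tri≈ _ u≡lo _ = ⊥-elim (u≢lo u≡lo)
  ... | tri< u<lo _ _ = subst (F._< d v) (sym (fixes-below d-rotates u u<lo)) u<dv
    where
    u<dv : u F.< d v
    u<dv with toℕ v ℕ.<? lo
    ... | yes v<lo = subst (u F.<_) (sym (fixes-below d-rotates v v<lo)) u<v
    ... | no v≮lo = <-≤-trans u<lo (rotates-lower-bound (≮⇒≥ v≮lo))
  ... | tri> _ _ lo<u with toℕ v ℕ.≤? hi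
  ...   | yes v≤hi = ℕ.≤-pred (subst₂ ℕ._<_ (sym (shifts-down d-rotates u lo<u (<⇒≤ (<-≤-trans u<v v≤hi))))
                                             (sym (shifts-down d-rotates v (<-trans lo<u u<v) v≤hi)) u<v)
  ...   | no v≰hi = subst (d u F.<_) (sym (fixes-above d-rotates v (≰⇒> v≰hi))) (≤-<-trans (rotates-non-increasing u≢lo) u<v)

  rotates-reflects : ∀ {u v} → toℕ u ≢ lo → toℕ v ≢ lo → d u F.< d v → u F.< v
  rotates-reflects {u} {v} u≢lo v≢lo du<dv with ℕ.<-cmp (toℕ u) (toℕ v)
  ... | tri< u<v _ _ = u<v
  ... | tri≈ _ u≡v _ = ⊥-elim (<-irrefl (cong (toℕ ∘ d) (FP.toℕ-injective u≡v)) du<dv)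
  ... | tri> _ _ v<u = ⊥-elim (<-asym du<dv (rotates-monotone v≢lo v<u))

record ArcCondition {n} (f : Fin n → Fin n) : Set where
  field
    descent-interior : ∀ x y → f x F.< y → y F.< x → y F.< f y
    ascent-interior  : ∀ x y → x F.< y → y F.< f x → f y F.< y
open ArcCondition

arcCondition-cong : ∀ {n} {f g : Fin n → Fin n} → f ≗ g → ArcCondition f → ArcCondition g
arcCondition-cong {f = f} {g} f≗g arc = record
  { descent-interior = λ x y gx<y y<x →
      subst (y F.<_) (f≗g y) (descent-interior arc x y (subst (F._< y) (sym (f≗g x)) gx<y) y<x)
  ; ascent-interior  = λ x y x<y y<gx →
      subst (F._< y) (f≗g y) (ascent-interior arc x y x<y (subst (y F.<_) (sym (f≗g x)) y<gx))
  }

arcCondition-id : ∀ {n} → ArcCondition {n} id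
arcCondition-id = record
  { descent-interior = λ x y x<y y<x → ⊥-elim (<-asym x<y y<x)
  ; ascent-interior  = λ x y x<y y<x → ⊥-elim (<-asym x<y y<x)
  }

module RotationAfter {n} {lo hi : ℕ} {d h : Fin n → Fin n} (d-rotates : Rotates lo hi d) (lo<hi : lo ℕ.< hi)
                     (h-injective : ∀ {x y} → h x ≡ h y → x ≡ y) (h-fixes : ∀ x → toℕ x ℕ.< hi → h x ≡ x) where

  f : Fin n → Fin n
  f x = d (h x)

  moved⇒above : ∀ {x} → h x ≢ x → hi ℕ.≤ toℕ x
  moved⇒above {x} hx≢x = ≮⇒≥ (hx≢x ∘ h-fixes x)

  h-above : ∀ {x} → hi ℕ.≤ toℕ x → hi ℕ.≤ toℕ (h x)
  h-above {x} hi≤x = ≮⇒≥ λ hx<hi →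
    <⇒≱ (subst (λ z → toℕ z ℕ.< hi) (h-injective (h-fixes (h x) hx<hi)) hx<hi) hi≤x

  h-onto-or-beyond : ∀ {x} → hi ℕ.≤ toℕ x → toℕ (h x) ≡ hi ⊎ hi ℕ.< toℕ (h x)
  h-onto-or-beyond hi≤x with m≤n⇒m<n∨m≡n (h-above hi≤x)
  ... | inj₁ hi<hx = inj₂ hi<hx
  ... | inj₂ hi≡hx = inj₁ (sym hi≡hx)

  f-below : ∀ x → toℕ x ℕ.< lo → f x ≡ x
  f-below x x<lo = trans (cong d (h-fixes x (<-trans x<lo lo<hi))) (fixes-below d-rotates x x<lo)

  f-at-lo : ∀ x → toℕ x ≡ lo → toℕ (f x) ≡ hi
  f-at-lo x x≡lo = trans (cong (toℕ ∘ d) (h-fixes x (subst (ℕ._< hi) (sym x≡lo) lo<hi))) (lo↦hi d-rotates x x≡lo)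

  f-inside : ∀ x → lo ℕ.< toℕ x → toℕ x ℕ.< hi → suc (toℕ (f x)) ≡ toℕ x
  f-inside x lo<x x<hi = trans (cong (suc ∘ toℕ ∘ d) (h-fixes x x<hi)) (shifts-down d-rotates x lo<x (<⇒≤ x<hi))

  f-onto-hi : ∀ x → toℕ (h x) ≡ hi → suc (toℕ (f x)) ≡ hi
  f-onto-hi x hx≡hi = trans (shifts-down d-rotates (h x) (subst (lo ℕ.<_) (sym hx≡hi) lo<hi) (≤-reflexive hx≡hi)) hx≡hi

  f-beyond : ∀ x → hi ℕ.< toℕ (h x) → f x ≡ h x
  f-beyond x = fixes-above d-rotates (h x)

  f≤h-above : ∀ x → hi ℕ.≤ toℕ x → f x F.≤ h x
  f≤h-above x hi≤x with h-onto-or-beyond hi≤x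
  ... | inj₁ hx≡hi = <⇒≤ (≤-reflexive (trans (f-onto-hi x hx≡hi) (sym hx≡hi)))
  ... | inj₂ hi<hx = ≤-reflexive (cong toℕ (f-beyond x hi<hx))

  f-ascends : ∀ y → hi ℕ.≤ toℕ y → y F.< h y → y F.< f y
  f-ascends y hi≤y y<hy = subst (y F.<_) (sym (f-beyond y (≤-<-trans hi≤y y<hy))) y<hy

  f-descends : ∀ y → hi ℕ.< toℕ y → h y F.< y → f y F.< y
  f-descends y hi<y hy<y with h-onto-or-beyond (<⇒≤ hi<y)
  ... | inj₁ hy≡hi = <-trans (≤-reflexive (f-onto-hi y hy≡hi)) hi<y
  ... | inj₂ hi<hy = subst (F._< y) (sym (f-beyond y hi<hy)) hy<y

  h-ascends : ∀ y → hi ℕ.< toℕ y → y F.< f y → y F.< h y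
  h-ascends y hi<y y<fy with h-onto-or-beyond (<⇒≤ hi<y)
  ... | inj₁ hy≡hi = ⊥-elim (<-asym y<fy (<-trans (≤-reflexive (f-onto-hi y hy≡hi)) hi<y))
  ... | inj₂ hi<hy = subst (y F.<_) (f-beyond y hi<hy) y<fy

  h-descends : ∀ y → hi ℕ.< toℕ y → f y F.< y → h y F.< y
  h-descends y hi<y fy<y with h-onto-or-beyond (<⇒≤ hi<y)
  ... | inj₁ hy≡hi = subst (ℕ._< toℕ y) (sym hy≡hi) hi<y
  ... | inj₂ hi<hy = subst (F._< y) (f-beyond y hi<hy) fy<y

  data Position (x : Fin n) : Set where
    below   : toℕ x ℕ.< lo → Position x
    at-lo   : toℕ x ≡ lo → Position x
    inside  : lo ℕ.< toℕ x → toℕ x ℕ.< hi → Position x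
    onto-hi : hi ℕ.≤ toℕ x → toℕ (h x) ≡ hi → Position x
    beyond  : hi ℕ.≤ toℕ x → hi ℕ.< toℕ (h x) → Position x

  position : ∀ x → Position x
  position x with ℕ.<-cmp (toℕ x) lo | toℕ x ℕ.<? hi
  ... | tri< x<lo _ _ | _        = below x<lo
  ... | tri≈ _ x≡lo _ | _        = at-lo x≡lo
  ... | tri> _ _ lo<x | yes x<hi = inside lo<x x<hi
  ... | tri> _ _ _    | no x≮hi with h-onto-or-beyond (≮⇒≥ x≮hi)
  ...   | inj₁ hx≡hi = onto-hi (≮⇒≥ x≮hi) hx≡hi
  ...   | inj₂ hi<hx = beyond (≮⇒≥ x≮hi) hi<hx

  arcCondition-preserved : ArcCondition h → ArcCondition f
  arcCondition-preserved arc-h = record { descent-interior = descent ; ascent-interior = ascent }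
    where
    descent : ∀ x y → f x F.< y → y F.< x → y F.< f y
    descent x y fx<y y<x with position x
    ... | below x<lo = ⊥-elim (<-asym y<x (subst (F._< y) (f-below x x<lo) fx<y))
    ... | at-lo x≡lo = ⊥-elim (<-asym lo<hi (subst₂ ℕ._<_ (f-at-lo x x≡lo) x≡lo (<-trans fx<y y<x)))
    ... | inside lo<x x<hi = ⊥-elim (<⇒≱ fx<y (ℕ.≤-pred (subst (toℕ y ℕ.<_) (sym (f-inside x lo<x x<hi)) y<x)))
    ... | beyond _ hi<hx =
      f-ascends y (<⇒≤ (<-trans hi<hx hx<y)) (descent-interior arc-h x y hx<y y<x)
      where
      hx<y : h x F.< y
      hx<y = subst (F._< y) (f-beyond x hi<hx) fx<y
    ... | onto-hi _ hx≡hi with m≤n⇒m<n∨m≡n hi≤y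
      where
      hi≤y : hi ℕ.≤ toℕ y
      hi≤y = subst (ℕ._≤ toℕ y) (f-onto-hi x hx≡hi) fx<y
    ...   | inj₁ hi<y = f-ascends y (<⇒≤ hi<y)
                          (descent-interior arc-h x y (subst (ℕ._< toℕ y) (sym hx≡hi) hi<y) y<x)
    ...   | inj₂ hi≡y with h-onto-or-beyond (≤-reflexive hi≡y)
    ...     | inj₁ hy≡hi = ⊥-elim (<-irrefl (cong toℕ (h-injective (FP.toℕ-injective (trans hy≡hi (sym hx≡hi))))) y<x)
    ...     | inj₂ hi<hy = f-ascends y (≤-reflexive hi≡y) (subst (ℕ._< toℕ (h y)) hi≡y hi<hy)

    ascent : ∀ x y → x F.< y → y F.< f x → f y F.< y
    ascent x y x<y y<fx with position x
    ... | below x<lo = ⊥-elim (<-asym x<y (subst (y F.<_) (f-below x x<lo) y<fx))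
    ... | at-lo x≡lo = ≤-reflexive (f-inside y (subst (ℕ._< toℕ y) x≡lo x<y) (subst (toℕ y ℕ.<_) (f-at-lo x x≡lo) y<fx))
    ... | inside lo<x x<hi = ⊥-elim (<-asym (<-trans x<y y<fx) (subst (toℕ (f x) ℕ.<_) (f-inside x lo<x x<hi) (n<1+n _)))
    ... | onto-hi hi≤x hx≡hi = ⊥-elim (<-asym (<-trans x<y y<fx) (<-≤-trans (≤-reflexive (f-onto-hi x hx≡hi)) hi≤x))
    ... | beyond hi≤x hi<hx =
      f-descends y (≤-<-trans hi≤x x<y) (ascent-interior arc-h x y x<y (subst (y F.<_) (f-beyond x hi<hx) y<fx))

  arcCondition-reflected : ArcCondition f → ArcCondition h
  arcCondition-reflected arc-f = record { descent-interior = descent ; ascent-interior = ascent }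
    where
    descent : ∀ x y → h x F.< y → y F.< x → y F.< h y
    descent x y hx<y y<x = h-ascends y (≤-<-trans (h-above hi≤x) hx<y)
                             (descent-interior arc-f x y (≤-<-trans (f≤h-above x hi≤x) hx<y) y<x)
      where
      hi≤x : hi ℕ.≤ toℕ x
      hi≤x = moved⇒above (λ hx≡x → <-asym (subst (F._< y) hx≡x hx<y) y<x)

    ascent : ∀ x y → x F.< y → y F.< h x → h y F.< y
    ascent x y x<y y<hx = cases (h-onto-or-beyond hi≤x)
      where
      hi≤x : hi ℕ.≤ toℕ x
      hi≤x = moved⇒above (λ hx≡x → <-asym x<y (subst (y F.<_) hx≡x y<hx))
      cases : toℕ (h x) ≡ hi ⊎ hi ℕ.< toℕ (h x) → h y F.< y
      cases (inj₁ hx≡hi) = ⊥-elim (<-asym (subst (toℕ y ℕ.<_) hx≡hi y<hx) (≤-<-trans hi≤x x<y))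
      cases (inj₂ hi<hx) = h-descends y (≤-<-trans hi≤x x<y)
                             (ascent-interior arc-f x y x<y (subst (y F.<_) (sym (f-beyond x hi<hx)) y<hx))

-- A later block [j′, k′] with k < k′ reaching down to k would contain the letter k itself.
letters-above : ∀ k (e : DExpr) → All (λ p → proj₂ p ℕ.≤ proj₁ p) e → All (λ p → k ℕ.< proj₁ p) e
              → (k ∈ letters e → ⊥) → All (k ℕ.<_) (letters e)
letters-above k [] _ _ _ = []
letters-above k ((k′ , j′) ∷ e) (j′≤k′ ∷ ordered) (k<k′ ∷ k<e) k∉ =
  AllP.++⁺ (All.tabulate above-k) (letters-above k e ordered k<e (k∉ ∘ ∈-++⁺ʳ (downFrom k′ j′)))
  where
  above-k : ∀ {ℓ} → ℓ ∈ downFrom k′ j′ → k ℕ.< ℓ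
  above-k ℓ∈ with ∈-downFrom⁻ j′≤k′ ℓ∈
  ... | j′≤ℓ , _ = ≰⇒> λ ℓ≤k → k∉ (∈-++⁺ˡ (∈-downFrom⁺ (≤-trans j′≤ℓ ℓ≤k) (<⇒≤ k<k′)))

uniqueLetters⇒arcCondition : ∀ {n} (e : DExpr) → WellFormed n e → Unique (letters e)
                           → ArcCondition {n} (evalWord (letters e))
uniqueLetters⇒arcCondition [] _ _ = arcCondition-id
uniqueLetters⇒arcCondition {n} ((k , suc lo) ∷ e) ((s≤s z≤n , 1+lo≤k , k≤n∸1) ∷ bounds , linked) unique =
  arcCondition-cong (λ x → sym (evalWord-++ (downFrom k (suc lo)) (letters e) x))
    (RotationAfter.arcCondition-preserved (downFrom-rotates 1+lo≤k k<n) 1+lo≤k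
       (evalWord-injective (letters e)) fixes-below-k
       (uniqueLetters⇒arcCondition e (bounds , Linked.tail linked) (unique-++⁻ʳ (downFrom k (suc lo)) unique)))
  where
  k<n : k ℕ.< n
  k<n = ≤∸1⇒< (≤-trans (s≤s z≤n) 1+lo≤k) k≤n∸1
  k<e : All (λ p → k ℕ.< proj₁ p) e
  k<e with Linked⇒AllPairs <-trans linked
  ... | k<keys ∷ _ = AllP.map⁻ k<keys
  fixes-below-k : ∀ x → toℕ x ℕ.< k → evalWord (letters e) x ≡ x
  fixes-below-k x = evalWord-fixes-below k (letters e) x
    (letters-above k e (All.map (proj₁ ∘ proj₂) bounds) k<e
      (unique-++⇒disjoint (downFrom k (suc lo)) unique (∈-downFrom⁺ 1+lo≤k ≤-refl)))

module Orbits {n} (π : Permutation′ n) where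

  π-injective : ∀ {x y} → π ⟨$⟩ʳ x ≡ π ⟨$⟩ʳ y → x ≡ y
  π-injective {x} {y} e = trans (sym (inverseˡ π)) (trans (cong (π ⟨$⟩ˡ_) e) (inverseˡ π))

  iter-+ : ∀ t u x → iter π (t + u) x ≡ iter π t (iter π u x)
  iter-+ zero u x = refl
  iter-+ (suc t) u x = cong (π ⟨$⟩ʳ_) (iter-+ t u x)

  iter-comm : ∀ t u x → iter π t (iter π u x) ≡ iter π u (iter π t x)
  iter-comm t u x = trans (sym (iter-+ t u x)) (trans (cong (λ v → iter π v x) (+-comm t u)) (iter-+ u t x))

  iter-injective : ∀ t {x y} → iter π t x ≡ iter π t y → x ≡ y
  iter-injective zero e = e
  iter-injective (suc t) e = iter-injective t (π-injective e)

  iter-∸-cancel : ∀ {i j} x → i ℕ.≤ j → iter π (j ∸ i) (iter π i x) ≡ iter π j x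
  iter-∸-cancel {i} {j} x i≤j = trans (sym (iter-+ (j ∸ i) i x)) (cong (λ v → iter π v x) (m∸n+n≡m i≤j))

  returns : ∀ x → ∃ λ p → 1 ℕ.≤ p × iter π p x ≡ x
  returns x with FP.pigeonhole (n<1+n n) (λ (t : Fin (suc n)) → iter π (toℕ t) x)
  ... | i , j , i<j , xᵢ≡xⱼ = toℕ j ∸ toℕ i , m<n⇒0<n∸m i<j ,
    iter-injective (toℕ i) (begin
      iter π (toℕ i) (iter π (toℕ j ∸ toℕ i) x) ≡⟨ iter-comm (toℕ i) (toℕ j ∸ toℕ i) x ⟩
      iter π (toℕ j ∸ toℕ i) (iter π (toℕ i) x) ≡⟨ iter-∸-cancel x (<⇒≤ i<j) ⟩
      iter π (toℕ j) x                          ≡⟨ sym xᵢ≡xⱼ ⟩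
      iter π (toℕ i) x                          ∎)
    where open ≡-Reasoning

  record IsCycleLength (x : Fin n) (s : ℕ) : Set where
    field
      positive : 1 ℕ.≤ s
      closes   : iter π s x ≡ x
      minimal  : ∀ r → 1 ℕ.≤ r → r ℕ.< s → iter π r x ≢ x

  cycleLength : ∀ x → ∃ (IsCycleLength x)
  cycleLength x with returns x
  ... | p , 1≤p , closes with minimal-witness (λ r → (1 ℕ.≤? r) ×-dec (iter π r x FP.≟ x)) p (1≤p , closes)
  ... | s , (1≤s , closesₛ) , _ , none-below =
    s , record { positive = 1≤s ; closes = closesₛ ; minimal = λ r 1≤r r<s e → none-below r r<s (1≤r , e) }

  iter-mod : ∀ {x s} → 1 ℕ.≤ s → iter π s x ≡ x → ∀ t → ∃ λ u → u ℕ.< s × iter π t x ≡ iter π u x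
  iter-mod 1≤s closes zero = zero , 1≤s , refl
  iter-mod {x} {s} 1≤s closes (suc t) with iter-mod 1≤s closes t
  ... | u , u<s , e with m≤n⇒m<n∨m≡n u<s
  ...   | inj₁ 1+u<s = suc u , 1+u<s , cong (π ⟨$⟩ʳ_) e
  ...   | inj₂ 1+u≡s = zero , 1≤s , trans (cong (π ⟨$⟩ʳ_) e) (trans (cong (λ v → iter π v x) 1+u≡s) closes)

  inOrbit-sym : ∀ {x y} → InOrbit π x y → InOrbit π y x
  inOrbit-sym {x} (t , refl) with returns x
  ... | p , 1≤p , closes with iter-mod 1≤p closes t
  ...   | u , u<p , e = p ∸ u , (begin
    iter π (p ∸ u) (iter π t x) ≡⟨ cong (iter π (p ∸ u)) e ⟩
    iter π (p ∸ u) (iter π u x) ≡⟨ iter-∸-cancel x (<⇒≤ u<p) ⟩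
    iter π p x                  ≡⟨ closes ⟩
    x                           ∎)
    where open ≡-Reasoning

  inOrbit-trans : ∀ {x y z} → InOrbit π x y → InOrbit π y z → InOrbit π x z
  inOrbit-trans {x} (t , refl) (u , refl) = u + t , iter-+ u t x

  inOrbit? : ∀ x y → Dec (InOrbit π x y)
  inOrbit? x y with returns x
  ... | p , 1≤p , closes with FP.any? (λ (u : Fin p) → iter π (toℕ u) x FP.≟ y)
  ...   | yes (u , e) = yes (toℕ u , e)
  ...   | no none = no λ (t , e) → let u , u<p , e′ = iter-mod 1≤p closes t in
    none (F.fromℕ< u<p , trans (cong (λ v → iter π v x) (FP.toℕ-fromℕ< u<p)) (trans (sym e′) e))

  iter-distinct : ∀ {x s} → IsCycleLength x s → ∀ {i j} → i ℕ.< j → j ℕ.< s → iter π i x ≢ iter π j x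
  iter-distinct {x} cyc {i} {j} i<j j<s xᵢ≡xⱼ =
    IsCycleLength.minimal cyc (j ∸ i) (m<n⇒0<n∸m i<j) (≤-<-trans (m∸n≤m j i) j<s)
      (iter-injective i (begin
        iter π i (iter π (j ∸ i) x) ≡⟨ iter-comm i (j ∸ i) x ⟩
        iter π (j ∸ i) (iter π i x) ≡⟨ iter-∸-cancel x (<⇒≤ i<j) ⟩
        iter π j x                  ≡⟨ sym xᵢ≡xⱼ ⟩
        iter π i x                  ∎))
    where open ≡-Reasoning

module ArcConditionOrbits {n} {π : Permutation′ n} (arc : ArcCondition (π ⟨$⟩ʳ_)) where
  open Orbits π

  gap-descends : ∀ {u v y} → InOrbit π u v → u F.< y → y F.< v → ¬ InOrbit π u y → π ⟨$⟩ʳ y F.< y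
  gap-descends {u} {y = y} (r , refl) u<y y<v y∉ with upward-crossing (λ t → iter π t u) r u<y y<v (λ t _ → y∉ ∘ (t ,_))
  ... | t , _ , uₜ<y , y<uₜ₊₁ = ascent-interior arc (iter π t u) y uₜ<y y<uₜ₊₁

  gap-ascends : ∀ {u v y} → InOrbit π v u → u F.< y → y F.< v → ¬ InOrbit π v y → y F.< π ⟨$⟩ʳ y
  gap-ascends {v = v} {y} (r , refl) u<y y<v y∉ with downward-crossing (λ t → iter π t v) r y<v u<y (λ t _ → y∉ ∘ (t ,_))
  ... | t , _ , y<vₜ , vₜ₊₁<y = descent-interior arc (iter π t v) y vₜ₊₁<y y<vₜ

  arcCondition⇒connected : Connected π
  arcCondition⇒connected x with returns x
  ... | p , 1≤p , closes = min , max , λ y → mk⇔ (bounded y) (filled y)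
    where
    orbit : ℕ → Fin n
    orbit t = iter π t x
    lowest : ∃ λ u → u ℕ.≤ p ∸ 1 × ∀ v → v ℕ.≤ p ∸ 1 → orbit u F.≤ orbit v
    lowest = argmin-prefix orbit (p ∸ 1)
    highest : ∃ λ u → u ℕ.≤ p ∸ 1 × ∀ v → v ℕ.≤ p ∸ 1 → orbit v F.≤ orbit u
    highest = argmax-prefix orbit (p ∸ 1)
    min max : Fin n
    min = orbit (proj₁ lowest)
    max = orbit (proj₁ highest)

    bounded : ∀ y → InOrbit π x y → min F.≤ y × y F.≤ max
    bounded y (t , refl) with iter-mod 1≤p closes t
    ... | u , u<p , xₜ≡xᵤ rewrite xₜ≡xᵤ =
      proj₂ (proj₂ lowest) u (<⇒≤∸1 u<p) , proj₂ (proj₂ highest) u (<⇒≤∸1 u<p)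

    filled : ∀ y → min F.≤ y × y F.≤ max → InOrbit π x y
    filled y (min≤y , y≤max) with inOrbit? x y
    ... | yes y∈ = y∈
    ... | no y∉ = ⊥-elim (<-asym (gap-descends min↝max min<y y<max (y∉ ∘ inOrbit-trans (proj₁ lowest , refl)))
                                 (gap-ascends (inOrbit-sym min↝max) min<y y<max (y∉ ∘ inOrbit-trans (proj₁ highest , refl))))
      where
      min<y : min F.< y
      min<y = FP.≤∧≢⇒< min≤y λ min≡y → y∉ (proj₁ lowest , min≡y)
      y<max : y F.< max
      y<max = FP.≤∧≢⇒< y≤max λ y≡max → y∉ (proj₁ highest , sym y≡max)
      min↝max : InOrbit π min max
      min↝max = inOrbit-trans (inOrbit-sym (proj₁ lowest , refl)) (proj₁ highest , refl)

  arcCondition⇒unimodal : Unimodal π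
  arcCondition⇒unimodal k₁ s k₁-max 1≤s closes minimal
    with minimal-witness (λ t → (1 ℕ.≤? t) ×-dec ((t ℕ.≟ s) ⊎-dec (iter π (t ∸ 1) k₁ FP.<? iter π t k₁)))
                         s (1≤s , inj₁ refl)
  ... | m , (1≤m , m-ascends) , m≤s , none-before = m , 1≤m , m≤s , descending , ascending
    where
    cyc : IsCycleLength k₁ s
    cyc = record { positive = 1≤s ; closes = closes ; minimal = minimal }
    a : ℕ → Fin n
    a t = iter π t k₁

    descending : ∀ t → 1 ℕ.≤ t → t ℕ.< m → a t F.< a (t ∸ 1)
    descending t 1≤t t<m with ℕ.<-cmp (toℕ (a t)) (toℕ (a (t ∸ 1)))
    ... | tri< aₜ<aₜ₋₁ _ _ = aₜ<aₜ₋₁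
    ... | tri≈ _ aₜ≡aₜ₋₁ _ =
      ⊥-elim (iter-distinct cyc (∸-monoʳ-< ℕ.z<s 1≤t) (<-≤-trans t<m m≤s) (sym (FP.toℕ-injective aₜ≡aₜ₋₁)))
    ... | tri> _ _ aₜ₋₁<aₜ = ⊥-elim (none-before t t<m (1≤t , inj₂ aₜ₋₁<aₜ))

    ascends-above-bottom : ∀ t → m ℕ.≤ t → t ℕ.< s → a (m ∸ 1) F.< a t → a t F.< a (suc t)
    ascends-above-bottom t m≤t t<s bottom<aₜ with downward-crossing a (m ∸ 1) aₜ<a₀ bottom<aₜ avoids
      where
      aₜ<a₀ : a t F.< a 0
      aₜ<a₀ = FP.≤∧≢⇒< (k₁-max t) λ aₜ≡a₀ → iter-distinct cyc (<-≤-trans 1≤m m≤t) t<s (sym aₜ≡a₀)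
      avoids : ∀ i → i ℕ.< m ∸ 1 → a i ≢ a t
      avoids i i<m-1 = iter-distinct cyc (<-≤-trans (<-≤-trans i<m-1 (m∸n≤m m 1)) m≤t) t<s
    ... | i , _ , aₜ<aᵢ , aᵢ₊₁<aₜ = descent-interior arc (a i) (a t) aᵢ₊₁<aₜ aₜ<aᵢ

    ascending-from-bottom : ∀ {t} → m ≤′ t → t ℕ.< s → a (m ∸ 1) F.≤ a (t ∸ 1) × a (t ∸ 1) F.< a t
    ascending-from-bottom ≤′-refl m<s = ≤-refl , [ (λ m≡s → ⊥-elim (<-irrefl m≡s m<s)) , id ]′ m-ascends
    ascending-from-bottom {suc t} (≤′-step m≤′t) 1+t<s with ascending-from-bottom m≤′t (<-trans (n<1+n t) 1+t<s)
    ... | bottom≤aₜ₋₁ , aₜ₋₁<aₜ =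
      <⇒≤ bottom<aₜ , ascends-above-bottom t (≤′⇒≤ m≤′t) (<-trans (n<1+n t) 1+t<s) bottom<aₜ
      where
      bottom<aₜ : a (m ∸ 1) F.< a t
      bottom<aₜ = ≤-<-trans bottom≤aₜ₋₁ aₜ₋₁<aₜ

    ascending : ∀ t → m ℕ.≤ t → t ℕ.< s → a (t ∸ 1) F.< a t
    ascending t m≤t t<s = proj₂ (ascending-from-bottom (≤⇒≤′ m≤t) t<s)

module UnimodalCycle {n} (π : Permutation′ n) {b : Fin n} {s m : ℕ} (cyc : Orbits.IsCycleLength π b s)
                     (2≤s : 2 ℕ.≤ s) (b-max : ∀ t → iter π t b F.≤ b)
                     (descending : ∀ t → 1 ℕ.≤ t → t ℕ.< m → iter π t b F.< iter π (t ∸ 1) b)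
                     (ascending : ∀ t → m ℕ.≤ t → t ℕ.< s → iter π (t ∸ 1) b F.< iter π t b) where
  open Orbits π
  open IsCycleLength cyc

  a : ℕ → Fin n
  a t = iter π t b

  moves : ∀ u → u ℕ.< s → a u ≢ a (suc u)
  moves u u<s with m≤n⇒m<n∨m≡n u<s
  ... | inj₁ 1+u<s = iter-distinct cyc (n<1+n u) 1+u<s
  ... | inj₂ 1+u≡s = λ aᵤ≡aᵤ₊₁ →
    minimal u (ℕ.≤-pred (subst (2 ℕ.≤_) (sym 1+u≡s) 2≤s)) u<s (trans aᵤ≡aᵤ₊₁ (trans (cong a 1+u≡s) closes))

  descending-chain : ∀ {p q} → p ℕ.< q → q ℕ.< m → a q F.< a p
  descending-chain {p} {suc q} (s≤s p≤q) 1+q<m with m≤n⇒m<n∨m≡n p≤q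
  ... | inj₁ p<q = <-trans (descending (suc q) (s≤s z≤n) 1+q<m) (descending-chain p<q (<-trans (n<1+n q) 1+q<m))
  ... | inj₂ refl = descending (suc q) (s≤s z≤n) 1+q<m

  ascending-step : ∀ t → m ℕ.≤ t → t ℕ.≤ s → a (t ∸ 1) F.< a t
  ascending-step t m≤t t≤s with m≤n⇒m<n∨m≡n t≤s
  ... | inj₁ t<s = ascending t m≤t t<s
  ... | inj₂ refl = subst (a (s ∸ 1) F.<_) (sym closes)
      (FP.≤∧≢⇒< (b-max (s ∸ 1)) λ aₛ₋₁≡b →
        moves (s ∸ 1) s∸1<s (trans aₛ₋₁≡b (trans (sym closes) (cong a (sym 1+[s∸1]≡s)))))
    where
    s∸1<s : s ∸ 1 ℕ.< s
    s∸1<s = ∸-monoʳ-< ℕ.z<s positive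
    1+[s∸1]≡s : suc (s ∸ 1) ≡ s
    1+[s∸1]≡s = trans (+-comm 1 (s ∸ 1)) (m∸n+n≡m positive)

  ascending-chain : ∀ {p q} → m ℕ.≤ suc p → p ℕ.< q → q ℕ.≤ s → a p F.< a q
  ascending-chain {p} {suc q} m≤1+p (s≤s p≤q) 1+q≤s with m≤n⇒m<n∨m≡n p≤q
  ... | inj₁ p<q = <-trans (ascending-chain m≤1+p p<q (<⇒≤ 1+q≤s)) (ascending-step (suc q) (≤-trans m≤1+p (s≤s p≤q)) 1+q≤s)
  ... | inj₂ refl = ascending-step (suc q) m≤1+p 1+q≤s

  descent-early : ∀ u → u ℕ.< s → a (suc u) F.< a u → suc u ℕ.< m
  descent-early u u<s aᵤ₊₁<aᵤ with suc u ℕ.<? m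
  ... | yes 1+u<m = 1+u<m
  ... | no 1+u≮m = ⊥-elim (<-asym aᵤ₊₁<aᵤ (ascending-step (suc u) (≮⇒≥ 1+u≮m) u<s))

  ascent-late : ∀ u → u ℕ.< s → a u F.< a (suc u) → m ℕ.≤ suc u
  ascent-late u u<s aᵤ<aᵤ₊₁ with suc u ℕ.<? m
  ... | no 1+u≮m = ≮⇒≥ 1+u≮m
  ... | yes 1+u<m = ⊥-elim (<-asym aᵤ<aᵤ₊₁ (descending (suc u) (s≤s z≤n) 1+u<m))

  descending-reflects : ∀ {p q} → p ℕ.< m → q ℕ.< m → a q F.< a p → p ℕ.< q
  descending-reflects {p} {q} p<m q<m aq<ap with ℕ.<-cmp p q
  ... | tri< p<q _ _ = p<q
  ... | tri≈ _ refl _ = ⊥-elim (<-irrefl refl aq<ap)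
  ... | tri> _ _ q<p = ⊥-elim (<-asym aq<ap (descending-chain q<p p<m))

  ascending-reflects : ∀ {p q} → m ℕ.≤ suc p → p ℕ.≤ s → m ℕ.≤ suc q → q ℕ.≤ s → a p F.< a q → p ℕ.< q
  ascending-reflects {p} {q} m≤1+p p≤s m≤1+q q≤s ap<aq with ℕ.<-cmp p q
  ... | tri< p<q _ _ = p<q
  ... | tri≈ _ refl _ = ⊥-elim (<-irrefl refl ap<aq)
  ... | tri> _ _ q<p = ⊥-elim (<-asym ap<aq (ascending-chain m≤1+q q<p p≤s))

  descent-interior-ascends : ∀ {u v} → u ℕ.< s → v ℕ.< s → a (suc u) F.< a v → a v F.< a u → a v F.< a (suc v)
  descent-interior-ascends {u} {v} u<s v<s aᵤ₊₁<aᵥ aᵥ<aᵤ with ℕ.<-cmp (toℕ (a v)) (toℕ (a (suc v)))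
  ... | tri< aᵥ<aᵥ₊₁ _ _ = aᵥ<aᵥ₊₁
  ... | tri≈ _ aᵥ≡aᵥ₊₁ _ = ⊥-elim (moves v v<s (FP.toℕ-injective aᵥ≡aᵥ₊₁))
  ... | tri> _ _ aᵥ₊₁<aᵥ = ⊥-elim (<⇒≱ (descending-reflects u<m v<m aᵥ<aᵤ) (ℕ.≤-pred (descending-reflects v<m 1+u<m aᵤ₊₁<aᵥ)))
    where
    1+u<m : suc u ℕ.< m
    1+u<m = descent-early u u<s (<-trans aᵤ₊₁<aᵥ aᵥ<aᵤ)
    u<m : u ℕ.< m
    u<m = <-trans (n<1+n u) 1+u<m
    v<m : v ℕ.< m
    v<m = <-trans (n<1+n v) (descent-early v v<s aᵥ₊₁<aᵥ)

  ascent-interior-descends : ∀ {u v} → u ℕ.< s → v ℕ.< s → a u F.< a v → a v F.< a (suc u) → a (suc v) F.< a v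
  ascent-interior-descends {u} {v} u<s v<s aᵤ<aᵥ aᵥ<aᵤ₊₁ with ℕ.<-cmp (toℕ (a (suc v))) (toℕ (a v))
  ... | tri< aᵥ₊₁<aᵥ _ _ = aᵥ₊₁<aᵥ
  ... | tri≈ _ aᵥ₊₁≡aᵥ _ = ⊥-elim (moves v v<s (sym (FP.toℕ-injective aᵥ₊₁≡aᵥ)))
  ... | tri> _ _ aᵥ<aᵥ₊₁ = ⊥-elim (<⇒≱ (ascending-reflects m≤1+u (<⇒≤ u<s) m≤1+v (<⇒≤ v<s) aᵤ<aᵥ)
                                      (ℕ.≤-pred (ascending-reflects m≤1+v (<⇒≤ v<s) m≤2+u u<s aᵥ<aᵤ₊₁)))
    where
    m≤1+u : m ℕ.≤ suc u
    m≤1+u = ascent-late u u<s (<-trans aᵤ<aᵥ aᵥ<aᵤ₊₁)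
    m≤2+u : m ℕ.≤ suc (suc u)
    m≤2+u = m≤n⇒m≤1+n m≤1+u
    m≤1+v : m ℕ.≤ suc v
    m≤1+v = ascent-late v v<s aᵥ<aᵥ₊₁

module ConnectedUnimodal {n} {π : Permutation′ n} (connected : Connected π) (unimodal : Unimodal π) (x : Fin n) where
  open Orbits π
  open Equivalence

  i₀ b : Fin n
  i₀ = proj₁ (connected x)
  b = proj₁ (proj₂ (connected x))

  orbit⇔interval : ∀ y → InOrbit π x y ⇔ (i₀ F.≤ y × y F.≤ b)
  orbit⇔interval = proj₂ (proj₂ (connected x))

  x-bounds : i₀ F.≤ x × x F.≤ b
  x-bounds = to (orbit⇔interval x) (0 , refl)

  πx-bounds : i₀ F.≤ π ⟨$⟩ʳ x × π ⟨$⟩ʳ x F.≤ b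
  πx-bounds = to (orbit⇔interval (π ⟨$⟩ʳ x)) (1 , refl)

  x↝b : InOrbit π x b
  x↝b = from (orbit⇔interval b) (≤-trans (proj₁ x-bounds) (proj₂ x-bounds) , ≤-refl)

  b-max : ∀ t → iter π t b F.≤ b
  b-max t = proj₂ (to (orbit⇔interval _) (inOrbit-trans x↝b (t , refl)))

  s : ℕ
  s = proj₁ (cycleLength b)
  cyc : IsCycleLength b s
  cyc = proj₂ (cycleLength b)
  open IsCycleLength cyc

  index : ∀ {y} → InOrbit π x y → ∃ λ v → v ℕ.< s × y ≡ iter π v b
  index {y} x↝y with inOrbit-trans (inOrbit-sym x↝b) x↝y
  ... | t , bₜ≡y with iter-mod positive closes t
  ...   | v , v<s , bₜ≡bᵥ = v , v<s , trans (sym bₜ≡y) bₜ≡bᵥ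

  2≤s : π ⟨$⟩ʳ x ≢ x → 2 ℕ.≤ s
  2≤s x-moves with index (0 , refl)
  ... | v , v<s , x≡bᵥ = ≤∧≢⇒< positive λ { 1≡s → x-moves (fixed v<s 1≡s x≡bᵥ) }
    where
    fixed : ∀ {v} → v ℕ.< s → 1 ≡ s → x ≡ iter π v b → π ⟨$⟩ʳ x ≡ x
    fixed {zero} _ 1≡s x≡b = trans (cong (π ⟨$⟩ʳ_) x≡b) (trans (subst (λ r → iter π r b ≡ b) (sym 1≡s) closes) (sym x≡b))
    fixed {suc v} 1+v<s 1≡s _ = ⊥-elim (<⇒≱ (subst (suc v ℕ.<_) (sym 1≡s) 1+v<s) (s≤s z≤n))

  m : ℕ
  m = proj₁ (unimodal b s b-max positive closes minimal)

  descending : ∀ t → 1 ℕ.≤ t → t ℕ.< m → iter π t b F.< iter π (t ∸ 1) b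
  descending = proj₁ (proj₂ (proj₂ (proj₂ (unimodal b s b-max positive closes minimal))))

  ascending : ∀ t → m ℕ.≤ t → t ℕ.< s → iter π (t ∸ 1) b F.< iter π t b
  ascending = proj₂ (proj₂ (proj₂ (proj₂ (unimodal b s b-max positive closes minimal))))

  module Cycle (x-moves : π ⟨$⟩ʳ x ≢ x) = UnimodalCycle π cyc (2≤s x-moves) b-max descending ascending

  u : ℕ
  u = proj₁ (index (0 , refl))
  u<s : u ℕ.< s
  u<s = proj₁ (proj₂ (index (0 , refl)))
  x≡bᵤ : x ≡ iter π u b
  x≡bᵤ = proj₂ (proj₂ (index (0 , refl)))

  interval⇒index : ∀ {y} → i₀ F.≤ y → y F.≤ b → ∃ λ v → v ℕ.< s × y ≡ iter π v b
  interval⇒index i₀≤y y≤b = index (from (orbit⇔interval _) (i₀≤y , y≤b))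

  descent-interior-ascends : ∀ y → π ⟨$⟩ʳ x F.< y → y F.< x → y F.< π ⟨$⟩ʳ y
  descent-interior-ascends y πx<y y<x with interval⇒index (≤-trans (proj₁ πx-bounds) (<⇒≤ πx<y)) (≤-trans (<⇒≤ y<x) (proj₂ x-bounds))
  ... | v , v<s , y≡bᵥ = subst₂ F._<_ (sym y≡bᵥ) (sym (cong (π ⟨$⟩ʳ_) y≡bᵥ))
    (Cycle.descent-interior-ascends (λ πx≡x → <-irrefl (cong toℕ πx≡x) (<-trans πx<y y<x)) u<s v<s
      (subst₂ F._<_ (cong (π ⟨$⟩ʳ_) x≡bᵤ) y≡bᵥ πx<y) (subst₂ F._<_ y≡bᵥ x≡bᵤ y<x))

  ascent-interior-descends : ∀ y → x F.< y → y F.< π ⟨$⟩ʳ x → π ⟨$⟩ʳ y F.< y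
  ascent-interior-descends y x<y y<πx with interval⇒index (≤-trans (proj₁ x-bounds) (<⇒≤ x<y)) (≤-trans (<⇒≤ y<πx) (proj₂ πx-bounds))
  ... | v , v<s , y≡bᵥ = subst₂ F._<_ (sym (cong (π ⟨$⟩ʳ_) y≡bᵥ)) (sym y≡bᵥ)
    (Cycle.ascent-interior-descends (λ πx≡x → <-irrefl (cong toℕ (sym πx≡x)) (<-trans x<y y<πx)) u<s v<s
      (subst₂ F._<_ x≡bᵤ y≡bᵥ x<y) (subst₂ F._<_ y≡bᵥ (cong (π ⟨$⟩ʳ_) x≡bᵤ) y<πx))

connected∧unimodal⇒arcCondition : ∀ {n} {π : Permutation′ n} → Connected π → Unimodal π → ArcCondition (π ⟨$⟩ʳ_)
connected∧unimodal⇒arcCondition connected unimodal = record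
  { descent-interior = λ x → ConnectedUnimodal.descent-interior-ascends connected unimodal x
  ; ascent-interior  = λ x → ConnectedUnimodal.ascent-interior-descends connected unimodal x
  }


isInversion? : ∀ {n} (g : Fin n → Fin n) (p : Fin n × Fin n) → Dec (proj₁ p F.< proj₂ p × g (proj₂ p) F.< g (proj₁ p))
isInversion? g p = (proj₁ p FP.<? proj₂ p) ×-dec (g (proj₂ p) FP.<? g (proj₁ p))

inversionCount : ∀ {n} → (Fin n → Fin n) → ℕ
inversionCount {n} g = count (isInversion? g) (cartesianProduct (allFin n) (allFin n))

inversionCount-cong : ∀ {n} {g g′ : Fin n → Fin n} → g ≗ g′ → inversionCount g ≡ inversionCount g′
inversionCount-cong {n} g≗g′ = count-cong _ _
  (λ _ (i<j , gj<gi) → i<j , subst₂ F._<_ (g≗g′ _) (g≗g′ _) gj<gi)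
  (λ _ (i<j , gj<gi) → i<j , subst₂ F._<_ (sym (g≗g′ _)) (sym (g≗g′ _)) gj<gi)
  (cartesianProduct (allFin n) (allFin n))

inversionCount-id : ∀ {n} {g : Fin n → Fin n} → g ≗ id → inversionCount g ≡ 0
inversionCount-id {n} g≗id = count-none _ (λ _ (i<j , gj<gi) → <-asym i<j (subst₂ F._<_ (g≗id _) (g≗id _) gj<gi))
  (cartesianProduct (allFin n) (allFin n))

module RotationInversions {n} {lo hi : ℕ} {d g g⁻¹ : Fin n → Fin n} {x₀ : Fin n} (x₀≡lo : toℕ x₀ ≡ lo)
                          (d-rotates : Rotates lo hi d) (lo<hi : lo ℕ.< hi) (hi<n : hi ℕ.< n)
                          (g-injective : ∀ {x y} → g x ≡ g y → x ≡ y) (g-fixes : ∀ x → toℕ x ℕ.< hi → g x ≡ x)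
                          (g-inverseʳ : ∀ y → g (g⁻¹ y) ≡ y) where
  open RotationAfter d-rotates lo<hi g-injective g-fixes

  ys : List (Fin n)
  ys = allFin n

  g-x₀ : g x₀ ≡ x₀
  g-x₀ = g-fixes x₀ (subst (ℕ._< hi) (sym x₀≡lo) lo<hi)

  g-off-lo : ∀ {q} → q ≢ x₀ → toℕ (g q) ≢ lo
  g-off-lo q≢x₀ gq≡lo = q≢x₀ (g-injective (trans (FP.toℕ-injective (trans gq≡lo (sym x₀≡lo))) (sym g-x₀)))

  row-agrees : ∀ x → x ≢ x₀ → count (isInversion? f) (map (x ,_) ys) ≡ count (isInversion? g) (map (x ,_) ys)
  row-agrees x x≢x₀ = begin
    count (isInversion? f) (map (x ,_) ys)   ≡⟨ count-map (isInversion? f) (x ,_) ys ⟩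
    count (isInversion? f ∘ (x ,_)) ys       ≡⟨ count-cong _ _ f⇒g g⇒f ys ⟩
    count (isInversion? g ∘ (x ,_)) ys       ≡⟨ count-map (isInversion? g) (x ,_) ys ⟨
    count (isInversion? g) (map (x ,_) ys)   ∎
    where
    open ≡-Reasoning
    f⇒g : ∀ q → x F.< q × f q F.< f x → x F.< q × g q F.< g x
    f⇒g q (x<q , fq<fx) with q FP.≟ x₀
    ... | no q≢x₀ = x<q , rotates-reflects d-rotates (<⇒≤ lo<hi) (g-off-lo q≢x₀) (g-off-lo x≢x₀) fq<fx
    ... | yes refl = ⊥-elim (<-asym (<-trans x<lo lo<hi) (subst₂ ℕ._<_ (f-at-lo x₀ x₀≡lo) (cong toℕ (f-below x x<lo)) fq<fx))
      where
      x<lo : toℕ x ℕ.< lo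
      x<lo = subst (toℕ x ℕ.<_) x₀≡lo x<q
    g⇒f : ∀ q → x F.< q × g q F.< g x → x F.< q × f q F.< f x
    g⇒f q (x<q , gq<gx) with q FP.≟ x₀
    ... | no q≢x₀ = x<q , rotates-monotone d-rotates (<⇒≤ lo<hi) (g-off-lo q≢x₀) gq<gx
    ... | yes refl = ⊥-elim (<-asym x<q (subst₂ F._<_ g-x₀ (g-fixes x (<-trans x<q (subst (ℕ._< hi) (sym x₀≡lo) lo<hi))) gq<gx))

  row-x₀-before : count (isInversion? g) (map (x₀ ,_) ys) ≡ 0
  row-x₀-before = trans (count-map (isInversion? g) (x₀ ,_) ys) (count-none _ no-inversion ys)
    where
    no-inversion : ∀ q → ¬ (x₀ F.< q × g q F.< g x₀)
    no-inversion q (x₀<q , gq<gx₀) = <-asym x₀<q (subst₂ F._<_ (g-injective (g-fixes (g q) gq<hi)) g-x₀ gq<gx₀)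
      where
      gq<hi : toℕ (g q) ℕ.< hi
      gq<hi = <-trans (subst (toℕ (g q) ℕ.<_) (trans (cong toℕ g-x₀) x₀≡lo) gq<gx₀) lo<hi

  q₁ : Fin n
  q₁ = g⁻¹ (d x₀)

  g-q₁ : toℕ (g q₁) ≡ hi
  g-q₁ = trans (cong toℕ (g-inverseʳ (d x₀))) (lo↦hi d-rotates x₀ x₀≡lo)

  hi≤q₁ : hi ℕ.≤ toℕ q₁
  hi≤q₁ = ≮⇒≥ λ q₁<hi → <-irrefl (trans (sym (cong toℕ (g-fixes q₁ q₁<hi))) g-q₁) q₁<hi

  row-x₀-after : count (isInversion? f) (map (x₀ ,_) ys) ≡ hi ∸ lo
  row-x₀-after = begin
    count (isInversion? f) (map (x₀ ,_) ys)
      ≡⟨ count-map (isInversion? f) (x₀ ,_) ys ⟩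
    count (isInversion? f ∘ (x₀ ,_)) ys
      ≡⟨ count-cong _ (λ q → inside? q ⊎-dec (q FP.≟ q₁)) inversion⇒ ⇒inversion ys ⟩
    count (λ q → inside? q ⊎-dec (q FP.≟ q₁)) ys
      ≡⟨ count-⊎ inside? (FP._≟ q₁) (λ { q (_ , q<hi) refl → <⇒≱ q<hi hi≤q₁ }) ys ⟩
    count inside? ys + count (FP._≟ q₁) ys
      ≡⟨ cong₂ _+_ (count-allFin-range n (suc lo) hi (<⇒≤ hi<n)) (count-allFin-≡ q₁) ⟩
    (hi ∸ suc lo) + 1
      ≡⟨ trans (+-comm _ 1) (sym (+-∸-assoc 1 lo<hi)) ⟩
    hi ∸ lo ∎
    where
    open ≡-Reasoning
    inside? : ∀ q → Dec (suc lo ℕ.≤ toℕ q × toℕ q ℕ.< hi)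
    inside? q = (suc lo ℕ.≤? toℕ q) ×-dec (toℕ q ℕ.<? hi)
    fx₀≡hi : toℕ (f x₀) ≡ hi
    fx₀≡hi = f-at-lo x₀ x₀≡lo
    inversion⇒ : ∀ q → x₀ F.< q × f q F.< f x₀ → (suc lo ℕ.≤ toℕ q × toℕ q ℕ.< hi) ⊎ q ≡ q₁
    inversion⇒ q (x₀<q , fq<fx₀) with toℕ q ℕ.<? hi
    ... | yes q<hi = inj₁ (subst (ℕ._< toℕ q) x₀≡lo x₀<q , q<hi)
    ... | no q≮hi with h-onto-or-beyond (≮⇒≥ q≮hi)
    ...   | inj₁ gq≡hi = inj₂ (g-injective (FP.toℕ-injective (trans gq≡hi (sym g-q₁))))
    ...   | inj₂ hi<gq = ⊥-elim (<-asym hi<gq (subst₂ ℕ._<_ (cong toℕ (f-beyond q hi<gq)) fx₀≡hi fq<fx₀))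
    ⇒inversion : ∀ q → (suc lo ℕ.≤ toℕ q × toℕ q ℕ.< hi) ⊎ q ≡ q₁ → x₀ F.< q × f q F.< f x₀
    ⇒inversion q (inj₁ (lo<q , q<hi)) =
      subst (ℕ._< toℕ q) (sym x₀≡lo) lo<q ,
      subst (toℕ (f q) ℕ.<_) (sym fx₀≡hi) (<-trans (subst (toℕ (f q) ℕ.<_) (f-inside q lo<q q<hi) (n<1+n _)) q<hi)
    ⇒inversion q (inj₂ refl) =
      subst (ℕ._< toℕ q₁) (sym x₀≡lo) (<-≤-trans lo<hi hi≤q₁) ,
      subst (toℕ (f q₁) ℕ.<_) (sym fx₀≡hi) (≤-reflexive (f-onto-hi q₁ g-q₁))

  inversionCount-rotation : inversionCount f ≡ (hi ∸ lo) + inversionCount g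
  inversionCount-rotation = begin
    inversionCount f
      ≡⟨ count-rows (isInversion? f) (isInversion? g) FP._≟_ ys x₀ (hi ∸ lo) row-agrees
                    (trans row-x₀-after (sym (trans (cong ((hi ∸ lo) +_) row-x₀-before) (+-identityʳ _)))) ys ⟩
    count (FP._≟ x₀) ys * (hi ∸ lo) + inversionCount g
      ≡⟨ cong (λ c → c * (hi ∸ lo) + inversionCount g) (count-allFin-≡ x₀) ⟩
    1 * (hi ∸ lo) + inversionCount g
      ≡⟨ cong (_+ inversionCount g) (*-identityˡ (hi ∸ lo)) ⟩
    (hi ∸ lo) + inversionCount g ∎
    where open ≡-Reasoning

module FirstMovedPoint {n} {h h⁻¹ : Fin n → Fin n} (arc : ArcCondition h) (h-injective : ∀ {x y} → h x ≡ h y → x ≡ y)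
                       (h-inverseʳ : ∀ y → h (h⁻¹ y) ≡ y)
                       {x₀ : Fin n} (x₀-moves : h x₀ ≢ x₀) (fixed-below : ∀ y → toℕ y ℕ.< toℕ x₀ → h y ≡ y) where
  lo hi : ℕ
  lo = toℕ x₀
  hi = toℕ (h x₀)

  hi<n : hi ℕ.< n
  hi<n = FP.toℕ<n (h x₀)

  lo<hi : lo ℕ.< hi
  lo<hi with ℕ.<-cmp lo hi
  ... | tri< lo<hi _ _ = lo<hi
  ... | tri≈ _ lo≡hi _ = ⊥-elim (x₀-moves (FP.toℕ-injective (sym lo≡hi)))
  ... | tri> _ _ hi<lo = ⊥-elim (x₀-moves (h-injective (fixed-below (h x₀) hi<lo)))

  -- If h z + 1 < z, the point y = h z + 1 is inside the descent arc of z, so it ascends; but it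
  -- is also inside the ascent arc of x₀ (h fixes everything below x₀), so it descends.
  shifts-down-inside : ∀ z → lo ℕ.< toℕ z → toℕ z ℕ.< hi → suc (toℕ (h z)) ≡ toℕ z
  shifts-down-inside z lo<z z<hi with m≤n⇒m<n∨m≡n (ascent-interior arc x₀ z lo<z z<hi)
  ... | inj₂ 1+hz≡z = 1+hz≡z
  ... | inj₁ 1+hz<z = ⊥-elim (<-irrefl refl (<-trans y<hy (ascent-interior arc x₀ y lo<y (<-trans y<z z<hi))))
    where
    y : Fin n
    y = F.fromℕ< (<-trans 1+hz<z (FP.toℕ<n z))
    hz<y : h z F.< y
    hz<y = ≤-reflexive (sym (FP.toℕ-fromℕ< (<-trans 1+hz<z (FP.toℕ<n z))))
    y<z : y F.< z
    y<z = subst (ℕ._< toℕ z) (sym (FP.toℕ-fromℕ< (<-trans 1+hz<z (FP.toℕ<n z)))) 1+hz<z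
    y<hy : y F.< h y
    y<hy = descent-interior arc z y hz<y y<z
    lo<y : lo ℕ.< toℕ y
    lo<y = ≰⇒> λ y≤lo → <-irrefl (cong toℕ (h-injective (fixed-below (h z) (<-≤-trans hz<y y≤lo)))) (<-trans hz<y y<z)

  d : Fin n → Fin n
  d = evalWord (downFrom hi (suc lo))

  d-rotates : Rotates lo hi d
  d-rotates = downFrom-rotates lo<hi hi<n

  agrees-with-rotation : ∀ z → toℕ z ℕ.< hi → h z ≡ d z
  agrees-with-rotation z z<hi with ℕ.<-cmp (toℕ z) lo
  ... | tri< z<lo _ _ = trans (fixed-below z z<lo) (sym (fixes-below d-rotates z z<lo))
  ... | tri≈ _ z≡lo _ = FP.toℕ-injective (trans (cong (toℕ ∘ h) (FP.toℕ-injective z≡lo)) (sym (lo↦hi d-rotates z z≡lo)))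
  ... | tri> _ _ lo<z = FP.toℕ-injective (suc-injective (trans (shifts-down-inside z lo<z z<hi)
                                                               (sym (shifts-down d-rotates z lo<z (<⇒≤ z<hi)))))

  g : Fin n → Fin n
  g z = evalWord (reverse (downFrom hi (suc lo))) (h z)

  d∘g≗h : ∀ z → d (g z) ≡ h z
  d∘g≗h z = evalWord-reverse-inverseʳ (downFrom hi (suc lo)) (h z)

  g-injective : ∀ {x y} → g x ≡ g y → x ≡ y
  g-injective = h-injective ∘ evalWord-injective (reverse (downFrom hi (suc lo)))

  g-inverseʳ : ∀ y → g (h⁻¹ (d y)) ≡ y
  g-inverseʳ y = trans (cong (evalWord (reverse (downFrom hi (suc lo)))) (h-inverseʳ (d y)))
                       (evalWord-reverse-inverseˡ (downFrom hi (suc lo)) y)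

  g-fixes : ∀ z → toℕ z ℕ.< hi → g z ≡ z
  g-fixes z z<hi = trans (cong (evalWord (reverse (downFrom hi (suc lo)))) (agrees-with-rotation z z<hi))
                         (evalWord-reverse-inverseˡ (downFrom hi (suc lo)) z)

  g-arc : ArcCondition g
  g-arc = RotationAfter.arcCondition-reflected d-rotates lo<hi g-injective g-fixes (arcCondition-cong (sym ∘ d∘g≗h) arc)

  inversions-d∘g : inversionCount (d ∘ g) ≡ (hi ∸ lo) + inversionCount g
  inversions-d∘g = RotationInversions.inversionCount-rotation refl d-rotates lo<hi hi<n g-injective g-fixes g-inverseʳ

record UniqueDExpression (n b : ℕ) (h : Fin n → Fin n) : Set where
  field
    expr            : DExpr
    wellFormed      : WellFormed n expr
    unique          : Unique (letters expr)
    letters-above-b : All (b ℕ.<_) (letters expr)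
    keys-above-b    : All (λ p → b ℕ.< proj₁ p) expr
    evaluates       : ∀ x → evalWord (letters expr) x ≡ h x
    reduced         : length (letters expr) ≡ inversionCount h

uniqueDExpression-cong : ∀ {n b} {h h′ : Fin n → Fin n} → h ≗ h′ → UniqueDExpression n b h → UniqueDExpression n b h′
uniqueDExpression-cong h≗h′ e = record
  { expr = expr ; wellFormed = wellFormed ; unique = unique ; letters-above-b = letters-above-b ; keys-above-b = keys-above-b
  ; evaluates = λ x → trans (evaluates x) (h≗h′ x) ; reduced = trans reduced (inversionCount-cong h≗h′) }
  where open UniqueDExpression e

prepend-rotation : ∀ {n b lo hi} {g : Fin n → Fin n} → b ℕ.≤ lo → lo ℕ.< hi → hi ℕ.< n
                 → inversionCount (evalWord (downFrom hi (suc lo)) ∘ g) ≡ (hi ∸ lo) + inversionCount g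
                 → UniqueDExpression n hi g → UniqueDExpression n b (evalWord (downFrom hi (suc lo)) ∘ g)
prepend-rotation {n} {b} {lo} {hi} {g} b≤lo lo<hi hi<n inversions e = record
  { expr            = (hi , suc lo) ∷ expr
  ; wellFormed      = (s≤s z≤n , lo<hi , <⇒≤∸1 hi<n) ∷ proj₁ wellFormed
                    , AllPairs⇒Linked (AllP.map⁺ keys-above-b ∷ Linked⇒AllPairs <-trans (proj₂ wellFormed))
  ; unique          = UniqueP.++⁺ (downFrom-unique lo<hi) unique
                        (λ (ℓ∈w , ℓ∈rest) → <⇒≱ (All.lookup letters-above-b ℓ∈rest) (proj₂ (∈-downFrom⁻ lo<hi ℓ∈w)))
  ; letters-above-b = AllP.++⁺ (All.tabulate (λ ℓ∈w → <-≤-trans (s≤s b≤lo) (proj₁ (∈-downFrom⁻ lo<hi ℓ∈w))))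
                               (All.map (<-trans b<hi) letters-above-b)
  ; keys-above-b    = b<hi ∷ All.map (<-trans b<hi) keys-above-b
  ; evaluates       = λ x → trans (evalWord-++ w (letters expr) x) (cong (evalWord w) (evaluates x))
  ; reduced         = begin
      length (w ++ letters expr)           ≡⟨ LP.length-++ w ⟩
      length w + length (letters expr)     ≡⟨ cong₂ _+_ (length-downFrom lo<hi) reduced ⟩
      suc (hi ∸ suc lo) + inversionCount g ≡⟨ cong (_+ inversionCount g) (+-∸-assoc 1 lo<hi) ⟨
      (hi ∸ lo) + inversionCount g         ≡⟨ inversions ⟨
      inversionCount (evalWord w ∘ g)      ∎
  }
  where
  open ≡-Reasoning
  open UniqueDExpression e
  w : List ℕ
  w = downFrom hi (suc lo)
  b<hi : b ℕ.< hi
  b<hi = ≤-<-trans b≤lo lo<hi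

-- Recursion on the fuel c, which bounds the number of positions at or above b.
arcCondition⇒uniqueDExpression : ∀ {n} c b (h h⁻¹ : Fin n → Fin n) → (∀ y → h (h⁻¹ y) ≡ y)
                               → (∀ {x y} → h x ≡ h y → x ≡ y) → ArcCondition h
                               → (∀ x → toℕ x ℕ.< b → h x ≡ x) → n ℕ.≤ b + c → UniqueDExpression n b h
arcCondition⇒uniqueDExpression {n} c b h h⁻¹ h-inverseʳ h-injective arc fixed-below-b n≤b+c
  with FP.all? (λ x → h x FP.≟ x)
... | yes h≗id = record
  { expr = [] ; wellFormed = [] , Linked.[] ; unique = [] ; letters-above-b = [] ; keys-above-b = []
  ; evaluates = λ x → sym (h≗id x) ; reduced = sym (inversionCount-id h≗id) }
... | no ¬h≗id with FP.¬∀⟶∃¬-smallest n _ (λ x → h x FP.≟ x) ¬h≗id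
...   | x₀ , x₀-moves , fixed-before = step c n≤b+c
  where
  fixed-below : ∀ y → toℕ y ℕ.< toℕ x₀ → h y ≡ y
  fixed-below y y<x₀ = subst (λ z → h z ≡ z) (FP.toℕ-injective (trans (FP.toℕ-inject j) (FP.toℕ-fromℕ< y<x₀))) (fixed-before j)
    where
    j : Fin (toℕ x₀)
    j = F.fromℕ< y<x₀
  open FirstMovedPoint arc h-injective h-inverseʳ x₀-moves fixed-below

  b≤lo : b ℕ.≤ lo
  b≤lo = ≮⇒≥ (x₀-moves ∘ fixed-below-b x₀)

  step : ∀ c → n ℕ.≤ b + c → UniqueDExpression n b h
  step zero n≤b+0 = ⊥-elim (x₀-moves (fixed-below-b x₀ (<-≤-trans (FP.toℕ<n x₀) (subst (n ℕ.≤_) (+-identityʳ b) n≤b+0))))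
  step (suc c) n≤b+1+c = uniqueDExpression-cong d∘g≗h (prepend-rotation b≤lo lo<hi hi<n inversions-d∘g
    (arcCondition⇒uniqueDExpression c hi g (h⁻¹ ∘ d) g-inverseʳ g-injective g-arc g-fixes n≤hi+c))
    where
    n≤hi+c : n ℕ.≤ hi + c
    n≤hi+c = ≤-trans n≤b+1+c (subst (ℕ._≤ hi + c) (sym (+-suc b c)) (+-monoˡ-≤ c (≤-<-trans b≤lo lo<hi)))

braidSimple⇔arcCondition : ∀ {n} (π : Permutation′ n) → BraidSimple π ⇔ ArcCondition (π ⟨$⟩ʳ_)
braidSimple⇔arcCondition {n} π = mk⇔ braidSimple⇒arcCondition arcCondition⇒braidSimple
  where
  braidSimple⇒arcCondition : BraidSimple π → ArcCondition (π ⟨$⟩ʳ_)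
  braidSimple⇒arcCondition (inj₁ π≗id) = arcCondition-cong (sym ∘ π≗id) arcCondition-id
  braidSimple⇒arcCondition (inj₂ (e , (wellFormed , evaluates , _) , unique)) =
    arcCondition-cong evaluates (uniqueLetters⇒arcCondition e wellFormed unique)

  arcCondition⇒braidSimple : ArcCondition (π ⟨$⟩ʳ_) → BraidSimple π
  arcCondition⇒braidSimple arc = inj₂ (expr , (wellFormed , evaluates , reduced) , unique)
    where
    open UniqueDExpression (arcCondition⇒uniqueDExpression n 0 (π ⟨$⟩ʳ_) (π ⟨$⟩ˡ_) (λ _ → inverseʳ π)
                                                           (Orbits.π-injective π) arc (λ _ ()) ≤-refl)

arcCondition⇔connected∧unimodal : ∀ {n} (π : Permutation′ n) → ArcCondition (π ⟨$⟩ʳ_) ⇔ (Connected π × Unimodal π)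
arcCondition⇔connected∧unimodal π = mk⇔
  (λ arc → ArcConditionOrbits.arcCondition⇒connected arc , ArcConditionOrbits.arcCondition⇒unimodal arc)
  (λ (connected , unimodal) → connected∧unimodal⇒arcCondition connected unimodal)

proposition2p5 : (n : ℕ) (π : Permutation′ n) → BraidSimple π ⇔ (Connected π × Unimodal π)
proposition2p5 n π = ⇔-trans (braidSimple⇔arcCondition π) (arcCondition⇔connected∧unimodal π)
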